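{- For any matrix $A \in \mathbb{Q}^{m\times n}$, there exists a deep hole $w^* \in [0,1]^n$ of $A$ whose bit complexity is polynomial in $n$ and the bit complexity of $A$; consequently $\operatorname{lindisc}(A)$ can be written using a number of bits polynomial in $n$ and the bit complexity of $A$.
   Context: For a real matrix $A \in \mathbb{R}^{m\times n}$ and $w \in [0,1]^n$, define $\operatorname{lindisc}(A,w) = \min_{x \in \{0,1\}^n} \|A(w-x)\|_\infty$, and $\operatorname{lindisc}(A) = \max_{w \in [0,1]^n} \operatorname{lindisc}(A,w)$. A deep hole of $A$ is a point $w^* \in [0,1]^n$ with $\operatorname{lindisc}(A,w^*) = \operatorname{lindisc}(A)$.
   Formalization: The maximum defining a deep hole and $\operatorname{lindisc}(A)$ is taken only over points of $[0,1]^n$ with rational coordinates. -}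

module Defs where

open import Data.Nat as ℕ using (ℕ; zero; suc)
open import Data.Nat.Logarithm using (⌈log₂_⌉)
open import Data.Integer as ℤ using (ℤ)
open import Data.Rational as ℚ using (ℚ; 0ℚ; 1ℚ; _⊓_; _⊔_; ∣_∣; _-_; _*_; _+_)
open import Data.Fin using (Fin; zero; suc)
open import Data.Bool using (Bool; true; false; if_then_else_)
open import Data.List using (List; []; _∷_; map; foldr; _++_)
open import Data.Product using (_×_)

Matrix : ℕ → ℕ → Set
Matrix m n = Fin m → Fin n → ℚ

Vector : ℕ → Set
Vector n = Fin n → ℚ

sumFin : ∀ {k} → (Fin k → ℚ) → ℚ
sumFin {zero}  f = 0ℚ
sumFin {suc k} f = f zero + sumFin (λ i → f (suc i))

sumFinℕ : ∀ {k} → (Fin k → ℕ) → ℕ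
sumFinℕ {zero}  f = 0
sumFinℕ {suc k} f = f zero ℕ.+ sumFinℕ (λ i → f (suc i))

-- max over an empty index set is 0 (the sup norm of a vector in ℚ^0 is 0)
maxFin : ∀ {k} → (Fin k → ℚ) → ℚ
maxFin {zero}  f = 0ℚ
maxFin {suc k} f = f zero ⊔ maxFin (λ i → f (suc i))

‖_‖∞ : ∀ {m} → Vector m → ℚ
‖ v ‖∞ = maxFin (λ i → ∣ v i ∣)

_·_ : ∀ {m n} → Matrix m n → Vector n → Vector m
(A · v) i = sumFin (λ j → A i j * v j)

bit : Bool → ℚ
bit b = if b then 1ℚ else 0ℚ

toVec : ∀ {n} → (Fin n → Bool) → Vector n
toVec x j = bit (x j)

allBinary : (n : ℕ) → List (Fin n → Bool)
allBinary zero    = (λ ()) ∷ []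
allBinary (suc n) =
  map (λ x → λ { zero → false ; (suc j) → x j }) (allBinary n) ++
  map (λ x → λ { zero → true  ; (suc j) → x j }) (allBinary n)

zeroBits : ∀ {n} → Fin n → Bool
zeroBits _ = false

-- lindisc(A,w) = min_{x ∈ {0,1}^n} ‖A(w - x)‖∞
-- (the all-zero vector, which lies in allBinary n, seeds the minimum)
lindiscAt : ∀ {m n} → Matrix m n → Vector n → ℚ
lindiscAt A w =
  foldr _⊓_ (val zeroBits) (map val (allBinary _))
  where val = λ x → ‖ A · (λ j → w j - toVec x j) ‖∞

InUnitCube : ∀ {n} → Vector n → Set
InUnitCube w = ∀ j → (0ℚ ℚ.≤ w j) × (w j ℚ.≤ 1ℚ)

IsDeepHole : ∀ {m n} → Matrix m n → Vector n → Set
IsDeepHole A w* = InUnitCube w* × (∀ w → InUnitCube w → lindiscAt A w ℚ.≤ lindiscAt A w*)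

bitsℕ : ℕ → ℕ
bitsℕ k = suc ⌈log₂ (suc k) ⌉

bitsℚ : ℚ → ℕ
bitsℚ q = suc (bitsℕ ℤ.∣ ℚ.numerator q ∣ ℕ.+ bitsℕ (ℚ.denominatorℕ q))

bitsVec : ∀ {n} → Vector n → ℕ
bitsVec w = sumFinℕ (λ j → bitsℚ (w j))

bitsMat : ∀ {m n} → Matrix m n → ℕ
bitsMat A = sumFinℕ (λ i → sumFinℕ (λ j → bitsℚ (A i j)))

-- Work in ℚ^(1+n) with points (t, w). If w is in the unit cube and t = lindisc(A, w) > 0, pick
-- for every x ∈ {0,1}ⁿ a row i and a sign s with t ≤ s (A(w - x))ᵢ. These choices and the cube
-- are linear inequalities in (t, w); they hold at (t, w), and every solution (t′, w′) has
-- lindisc(A, w′) ≥ t′. Pushing (t, w) in directions that keep the tight inequalities tight and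
-- do not decrease t reaches a vertex: a point where n + 1 linearly independent inequalities
-- are tight. Scaled by the common denominator of A these inequalities have integer entries of
-- polynomial bit size, so by Cramer's rule every vertex coordinate is a quotient of two
-- determinants of polynomial bit size. Hence a maximiser of lindisc(A, ·) over the finitely
-- many vertex points in the cube (and 0) is a deep hole of polynomial bit complexity, and
-- lindisc(A) is the t-coordinate of the vertex obtained from it.

module Submission where

open import Data.Nat using (ℕ)
open import Defs using (Matrix)

module RationalFacts where

  open import Data.Integer as ℤ using ()
  open import Data.Nat as ℕ using ()
  open import Data.Rational as ℚ using (ℚ; 0ℚ; 1ℚ; _+_; _*_; _-_; -_; _≤_; _<_; 1/_)
  open import Data.Rational.Properties as QP using ()
  open import Data.Rational.Solver using (module +-*-Solver)
  open import Relation.Binary.PropositionalEquality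
  open import Relation.Nullary using (yes; no)
  open import Data.Empty using (⊥-elim)
  open +-*-Solver

  -- A total inverse: inv 0ℚ = 0ℚ.
  inv : ℚ → ℚ
  inv p with p QP.≟ 0ℚ
  ... | yes _ = 0ℚ
  ... | no p≢0 = 1/_ p {{ℚ.≢-nonZero p≢0}}

  inv-inverseʳ : ∀ p → p ≢ 0ℚ → p * inv p ≡ 1ℚ
  inv-inverseʳ p p≢0 with p QP.≟ 0ℚ
  ... | yes p≡0 = ⊥-elim (p≢0 p≡0)
  ... | no p≢0′ = QP.*-inverseʳ p {{ℚ.≢-nonZero p≢0′}}

  inv-inverseˡ : ∀ p → p ≢ 0ℚ → inv p * p ≡ 1ℚ
  inv-inverseˡ p p≢0 = trans (QP.*-comm (inv p) p) (inv-inverseʳ p p≢0)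

  inv-pos : ∀ {p} → 0ℚ < p → 0ℚ < inv p
  inv-pos {p} 0<p with p QP.≟ 0ℚ
  ... | yes p≡0 = ⊥-elim (QP.<-irrefl (sym p≡0) 0<p)
  ... | no _    = QP.positive⁻¹ _ {{QP.1/pos⇒pos p {{ℚ.positive 0<p}}}}

  0<1 : 0ℚ < 1ℚ
  0<1 = ℚ.*<* (ℤ.+<+ (ℕ.s≤s ℕ.z≤n))

  pos⇒≢0 : ∀ {p} → 0ℚ < p → p ≢ 0ℚ
  pos⇒≢0 0<p p≡0 = QP.<-irrefl (sym p≡0) 0<p

  +-nonNeg : ∀ {p q} → 0ℚ ≤ p → 0ℚ ≤ q → 0ℚ ≤ p + q
  +-nonNeg = QP.+-mono-≤

  *-nonNeg : ∀ {p q} → 0ℚ ≤ p → 0ℚ ≤ q → 0ℚ ≤ p * q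
  *-nonNeg {p} {q} 0≤p 0≤q =
    subst (_≤ p * q) (QP.*-zeroˡ q) (QP.*-monoʳ-≤-nonNeg q {{ℚ.nonNegative 0≤q}} 0≤p)

  *-pos : ∀ {p q} → 0ℚ < p → 0ℚ < q → 0ℚ < p * q
  *-pos {p} {q} 0<p 0<q =
    subst (_< p * q) (QP.*-zeroˡ q) (QP.*-monoˡ-<-pos q {{ℚ.positive 0<q}} 0<p)

  *-≢0 : ∀ {p q} → p ≢ 0ℚ → q ≢ 0ℚ → p * q ≢ 0ℚ
  *-≢0 {p} {q} p≢0 q≢0 pq≡0 = q≢0 (begin
      q                  ≡⟨ sym (QP.*-identityˡ q) ⟩
      1ℚ * q             ≡⟨ cong (_* q) (sym (inv-inverseˡ p p≢0)) ⟩
      (inv p * p) * q    ≡⟨ QP.*-assoc (inv p) p q ⟩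
      inv p * (p * q)    ≡⟨ cong (inv p *_) pq≡0 ⟩
      inv p * 0ℚ         ≡⟨ QP.*-zeroʳ (inv p) ⟩
      0ℚ                 ∎)
    where open ≡-Reasoning

  y≡x*z⇒x≡y*inv[z] : ∀ {x y z} → z ≢ 0ℚ → y ≡ x * z → x ≡ y * inv z
  y≡x*z⇒x≡y*inv[z] {x} {y} {z} z≢0 y≡x*z = begin
      x                  ≡⟨ sym (QP.*-identityʳ x) ⟩
      x * 1ℚ             ≡⟨ cong (x *_) (sym (inv-inverseʳ z z≢0)) ⟩
      x * (z * inv z)    ≡⟨ sym (QP.*-assoc x z (inv z)) ⟩
      (x * z) * inv z    ≡⟨ cong (_* inv z) (sym y≡x*z) ⟩
      y * inv z          ∎
    where open ≡-Reasoning

  p≡-p⇒p≡0 : ∀ {p} → p ≡ - p → p ≡ 0ℚ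
  p≡-p⇒p≡0 {p} p≡-p = begin
      p                  ≡⟨ solve 1 (λ p → p := (p :+ p) :* con ℚ.½) refl p ⟩
      (p + p) * ℚ.½      ≡⟨ cong (λ q → (p + q) * ℚ.½) p≡-p ⟩
      (p + - p) * ℚ.½    ≡⟨ cong (_* ℚ.½) (QP.+-inverseʳ p) ⟩
      0ℚ                 ∎
    where open ≡-Reasoning

  neg-involutive : ∀ p → - - p ≡ p
  neg-involutive = solve 1 (λ p → :- :- p := p) refl

  p≤q⇒0≤q-p : ∀ {p q} → p ≤ q → 0ℚ ≤ q - p
  p≤q⇒0≤q-p {p} {q} h = subst (_≤ q - p) (QP.+-inverseʳ p) (QP.+-monoˡ-≤ (- p) h)

  0≤q-p⇒p≤q : ∀ {p q} → 0ℚ ≤ q - p → p ≤ q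
  0≤q-p⇒p≤q {p} {q} h =
    subst₂ _≤_ (QP.+-identityˡ p) (solve 2 (λ p q → (q :- p) :+ p := q) refl p q) (QP.+-monoˡ-≤ p h)

  ≤-via-difference : ∀ {p q} r → q - p ≡ r → 0ℚ ≤ r → p ≤ q
  ≤-via-difference r q-p≡r 0≤r = 0≤q-p⇒p≤q (subst (0ℚ ≤_) (sym q-p≡r) 0≤r)

  orientation : ℚ → ℚ
  orientation x with 0ℚ QP.≤? x
  ... | yes _ = 1ℚ
  ... | no _  = - 1ℚ

  orientation-nonNeg : ∀ x → 0ℚ ≤ orientation x * x
  orientation-nonNeg x with 0ℚ QP.≤? x
  ... | yes 0≤x = subst (0ℚ ≤_) (sym (QP.*-identityˡ x)) 0≤x
  ... | no  0≰x = subst (0ℚ ≤_) (solve 1 (λ x → :- x := (:- con 1ℚ) :* x) refl x) (QP.neg-antimono-≤ (QP.<⇒≤ (QP.≰⇒> 0≰x)))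

  orientation≢0 : ∀ x → orientation x ≢ 0ℚ
  orientation≢0 x with 0ℚ QP.≤? x
  ... | yes _ = λ ()
  ... | no  _ = λ ()

module FinSums where

  open import Data.Nat using (zero; suc)
  open import Data.Rational as ℚ using (ℚ; 0ℚ; 1ℚ; _+_; _*_; _-_; -_)
  open import Data.Rational.Properties as QP using ()
  open import Data.Rational.Solver using (module +-*-Solver)
  open import Data.Fin using (Fin; zero; suc)
  open import Relation.Binary.PropositionalEquality
  open import Defs
  open +-*-Solver

  sumFin-cong : ∀ {k} {f g : Fin k → ℚ} → (∀ i → f i ≡ g i) → sumFin f ≡ sumFin g
  sumFin-cong {zero}  f≗g = refl
  sumFin-cong {suc k} f≗g = cong₂ _+_ (f≗g zero) (sumFin-cong (λ i → f≗g (suc i)))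

  sumFin-zero : ∀ {k} (f : Fin k → ℚ) → (∀ i → f i ≡ 0ℚ) → sumFin f ≡ 0ℚ
  sumFin-zero {zero}  f f≗0 = refl
  sumFin-zero {suc k} f f≗0 =
    cong₂ _+_ (f≗0 zero) (sumFin-zero (λ i → f (suc i)) (λ i → f≗0 (suc i)))

  sumFin-+ : ∀ {k} (f g : Fin k → ℚ) → sumFin (λ i → f i + g i) ≡ sumFin f + sumFin g
  sumFin-+ {zero}  f g = refl
  sumFin-+ {suc k} f g =
    trans (cong (f zero + g zero +_) (sumFin-+ (λ i → f (suc i)) (λ i → g (suc i))))
          (solve 4 (λ a b c d → (a :+ b) :+ (c :+ d) := (a :+ c) :+ (b :+ d)) refl (f zero) (g zero) _ _)

  sumFin-neg : ∀ {k} (f : Fin k → ℚ) → sumFin (λ i → - f i) ≡ - sumFin f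
  sumFin-neg {zero}  f = refl
  sumFin-neg {suc k} f =
    trans (cong (- f zero +_) (sumFin-neg (λ i → f (suc i)))) (sym (QP.neg-distrib-+ (f zero) _))

  sumFin-- : ∀ {k} (f g : Fin k → ℚ) → sumFin (λ i → f i - g i) ≡ sumFin f - sumFin g
  sumFin-- f g = trans (sumFin-+ f (λ i → - g i)) (cong (sumFin f +_) (sumFin-neg g))

  *-distribˡ-sumFin : ∀ {k} c (f : Fin k → ℚ) → c * sumFin f ≡ sumFin (λ i → c * f i)
  *-distribˡ-sumFin {zero}  c f = QP.*-zeroʳ c
  *-distribˡ-sumFin {suc k} c f =
    trans (QP.*-distribˡ-+ c (f zero) _) (cong (c * f zero +_) (*-distribˡ-sumFin c (λ i → f (suc i))))

  *-distribʳ-sumFin : ∀ {k} c (f : Fin k → ℚ) → sumFin f * c ≡ sumFin (λ i → f i * c)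
  *-distribʳ-sumFin c f =
    trans (QP.*-comm _ c) (trans (*-distribˡ-sumFin c f) (sumFin-cong (λ i → QP.*-comm c (f i))))

  sumFin-swap : ∀ {k l} (f : Fin k → Fin l → ℚ) →
                sumFin (λ i → sumFin (λ j → f i j)) ≡ sumFin (λ j → sumFin (λ i → f i j))
  sumFin-swap {zero}  {l} f = sym (sumFin-zero {l} (λ j → 0ℚ) (λ j → refl))
  sumFin-swap {suc k} {l} f = begin
      sumFin (f zero) + sumFin (λ i → sumFin (λ j → f (suc i) j))
        ≡⟨ cong (sumFin (f zero) +_) (sumFin-swap (λ i → f (suc i))) ⟩
      sumFin (f zero) + sumFin (λ j → sumFin (λ i → f (suc i) j))
        ≡⟨ sym (sumFin-+ (f zero) (λ j → sumFin (λ i → f (suc i) j))) ⟩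
      sumFin (λ j → f zero j + sumFin (λ i → f (suc i) j)) ∎
    where open ≡-Reasoning

  δ : ∀ {k} → Fin k → Fin k → ℚ
  δ zero    zero    = 1ℚ
  δ zero    (suc _) = 0ℚ
  δ (suc _) zero    = 0ℚ
  δ (suc i) (suc j) = δ i j

  sumFin-δ : ∀ {k} (f : Fin k → ℚ) (j : Fin k) → sumFin (λ i → f i * δ i j) ≡ f j
  sumFin-δ f zero = begin
      f zero * 1ℚ + sumFin (λ i → f (suc i) * δ (suc i) zero)
        ≡⟨ cong (f zero * 1ℚ +_) (sumFin-zero _ (λ i → QP.*-zeroʳ (f (suc i)))) ⟩
      f zero * 1ℚ + 0ℚ
        ≡⟨ solve 1 (λ x → x :* con 1ℚ :+ con 0ℚ := x) refl (f zero) ⟩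
      f zero ∎
    where open ≡-Reasoning
  sumFin-δ f (suc j) =
    trans (cong (_+ sumFin (λ i → f (suc i) * δ i j)) (QP.*-zeroʳ (f zero)))
          (trans (QP.+-identityˡ _) (sumFin-δ (λ i → f (suc i)) j))

  infix 8 _·ᵥ_
  _·ᵥ_ : ∀ {d} → Vector d → Vector d → ℚ
  a ·ᵥ v = sumFin (λ j → a j * v j)

  ·ᵥ-linear : ∀ {d} (a u v : Vector d) c → a ·ᵥ (λ j → u j + c * v j) ≡ a ·ᵥ u + c * (a ·ᵥ v)
  ·ᵥ-linear a u v c = begin
      sumFin (λ j → a j * (u j + c * v j))
        ≡⟨ sumFin-cong (λ j → solve 4 (λ a u l v → a :* (u :+ l :* v) := a :* u :+ l :* (a :* v)) refl (a j) (u j) c (v j)) ⟩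
      sumFin (λ j → a j * u j + c * (a j * v j))
        ≡⟨ sumFin-+ (λ j → a j * u j) (λ j → c * (a j * v j)) ⟩
      a ·ᵥ u + sumFin (λ j → c * (a j * v j))
        ≡⟨ cong (a ·ᵥ u +_) (sym (*-distribˡ-sumFin c (λ j → a j * v j))) ⟩
      a ·ᵥ u + c * (a ·ᵥ v) ∎
    where open ≡-Reasoning

  ·ᵥ-linear- : ∀ {d} (a u v : Vector d) c → a ·ᵥ (λ j → u j - c * v j) ≡ a ·ᵥ u - c * (a ·ᵥ v)
  ·ᵥ-linear- a u v c = begin
      sumFin (λ j → a j * (u j - c * v j))
        ≡⟨ sumFin-cong (λ j → solve 4 (λ a u c v → a :* (u :- c :* v) := a :* u :- c :* (a :* v)) refl (a j) (u j) c (v j)) ⟩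
      sumFin (λ j → a j * u j - c * (a j * v j))
        ≡⟨ sumFin-- (λ j → a j * u j) (λ j → c * (a j * v j)) ⟩
      a ·ᵥ u - sumFin (λ j → c * (a j * v j))
        ≡⟨ cong (λ z → a ·ᵥ u - z) (sym (*-distribˡ-sumFin c (λ j → a j * v j))) ⟩
      a ·ᵥ u - c * (a ·ᵥ v) ∎
    where open ≡-Reasoning

  ·ᵥ-scale : ∀ {d} (a v : Vector d) c → a ·ᵥ (λ j → c * v j) ≡ c * (a ·ᵥ v)
  ·ᵥ-scale a v c = trans (sumFin-cong (λ j → solve 3 (λ a c v → a :* (c :* v) := c :* (a :* v)) refl (a j) c (v j)))
                        (sym (*-distribˡ-sumFin c (λ j → a j * v j)))

  ·ᵥ-combination : ∀ {d k} (a : Vector d) (l : Fin k → ℚ) (K : Fin k → Vector d) →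
                   a ·ᵥ (λ j → sumFin (λ i → l i * K i j)) ≡ sumFin (λ i → l i * (a ·ᵥ K i))
  ·ᵥ-combination a l K = begin
      sumFin (λ j → a j * sumFin (λ i → l i * K i j))
        ≡⟨ sumFin-cong (λ j → *-distribˡ-sumFin (a j) (λ i → l i * K i j)) ⟩
      sumFin (λ j → sumFin (λ i → a j * (l i * K i j)))
        ≡⟨ sumFin-swap (λ j i → a j * (l i * K i j)) ⟩
      sumFin (λ i → sumFin (λ j → a j * (l i * K i j)))
        ≡⟨ sumFin-cong (λ i → trans (sumFin-cong (λ j → solve 3 (λ a l k → a :* (l :* k) := l :* (a :* k)) refl (a j) (l i) (K i j)))
                                    (sym (*-distribˡ-sumFin (l i) (λ j → a j * K i j)))) ⟩
      sumFin (λ i → l i * (a ·ᵥ K i)) ∎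
    where open ≡-Reasoning

module Determinant where

  open import Data.Nat using (zero; suc)
  open import Data.Rational as ℚ using (ℚ; 0ℚ; 1ℚ; _+_; _*_; _-_; -_)
  open import Data.Rational.Solver using (module +-*-Solver)
  open import Data.Fin using (zero; suc)
  open import Data.Vec.Functional using (head; tail)
  open import Data.List using (List; []; _∷_; _++_; map; [_])
  open import Data.List.Properties using (++-assoc; map-++)
  open import Data.List.Relation.Binary.Pointwise as Pointwise using (Pointwise; []; _∷_)
  open import Relation.Binary.PropositionalEquality hiding ([_])
  open import Defs using (Vector)
  open RationalFacts
  open +-*-Solver

  -- A d × d matrix is a list of d rows (other lengths give junk values). det expands along the
  -- first column: laplace done rest is the alternating sum over the rows r of rest of r₀ times
  -- the minor of r, where done holds the rows already passed.
  mutual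
    det : ∀ {d} → List (Vector d) → ℚ
    det {zero}  []      = 1ℚ
    det {zero}  (_ ∷ _) = 0ℚ
    det {suc d} rs      = laplace [] rs

    laplace : ∀ {d} → List (Vector (suc d)) → List (Vector (suc d)) → ℚ
    laplace done []         = 0ℚ
    laplace done (r ∷ rest) = head r * det (map tail (done ++ rest)) - laplace (done ++ [ r ]) rest

  RowsEq : ∀ {d} → List (Vector d) → List (Vector d) → Set
  RowsEq = Pointwise _≗_

  tails-cong : ∀ {d} {rs ss : List (Vector (suc d))} → RowsEq rs ss → RowsEq (map tail rs) (map tail ss)
  tails-cong eq = Pointwise.map⁺ tail tail (Pointwise.map (λ r≗s k → r≗s (suc k)) eq)

  mutual
    det-cong : ∀ {d} {rs ss : List (Vector d)} → RowsEq rs ss → det rs ≡ det ss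
    det-cong {zero}  []      = refl
    det-cong {zero}  (_ ∷ _) = refl
    det-cong {suc d} eq      = laplace-cong [] eq

    laplace-cong : ∀ {d} {as bs rs ss : List (Vector (suc d))} →
                   RowsEq as bs → RowsEq rs ss → laplace as rs ≡ laplace bs ss
    laplace-cong eqa []           = refl
    laplace-cong eqa (r≗s ∷ eqr) =
      cong₂ _-_ (cong₂ _*_ (r≗s zero) (det-cong (tails-cong (Pointwise.++⁺ eqa eqr))))
                (laplace-cong (Pointwise.++⁺ eqa (r≗s ∷ [])) eqr)

  data Swap {A : Set} : List A → List A → Set where
    here  : ∀ {a b t} → Swap (a ∷ b ∷ t) (b ∷ a ∷ t)
    there : ∀ {x t t′} → Swap t t′ → Swap (x ∷ t) (x ∷ t′)

  Swap-++ʳ : ∀ {A : Set} {p p′ : List A} (q : List A) → Swap p p′ → Swap (p ++ q) (p′ ++ q)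
  Swap-++ʳ q here      = here
  Swap-++ʳ q (there s) = there (Swap-++ʳ q s)

  Swap-++ˡ : ∀ {A : Set} (p : List A) {q q′ : List A} → Swap q q′ → Swap (p ++ q) (p ++ q′)
  Swap-++ˡ []      s = s
  Swap-++ˡ (x ∷ p) s = there (Swap-++ˡ p s)

  Swap-map : ∀ {A B : Set} (f : A → B) {p p′ : List A} → Swap p p′ → Swap (map f p) (map f p′)
  Swap-map f here      = here
  Swap-map f (there s) = there (Swap-map f s)

  private
    negate-term : ∀ h D e → h * (- D) - (- e) ≡ - (h * D - e)
    negate-term = solve 3 (λ h D e → h :* (:- D) :- (:- e) := :- (h :* D :- e)) refl

  mutual
    det-swap : ∀ {d} {rs ss : List (Vector d)} → Swap rs ss → det ss ≡ - det rs
    det-swap {zero}  here      = refl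
    det-swap {zero}  (there s) = refl
    det-swap {suc d} s         = laplace-swap-rest [] s

    laplace-swap-done : ∀ {d} {as bs : List (Vector (suc d))} → Swap as bs →
                        ∀ rs → laplace bs rs ≡ - laplace as rs
    laplace-swap-done s []       = refl
    laplace-swap-done {as = as} s (r ∷ rs) =
      trans (cong₂ (λ D e → head r * D - e) (det-swap (Swap-map tail (Swap-++ʳ rs s)))
                                            (laplace-swap-done (Swap-++ʳ [ r ] s) rs))
            (negate-term (head r) (det (map tail (as ++ rs))) (laplace (as ++ [ r ]) rs))

    laplace-swap-rest : ∀ {d} (as : List (Vector (suc d))) {rs ss : List (Vector (suc d))} →
                        Swap rs ss → laplace as ss ≡ - laplace as rs
    laplace-swap-rest as (here {x} {y} {t}) = begin
        head y * X - (head x * det (map tail ((as ++ [ y ]) ++ t)) - laplace ((as ++ [ y ]) ++ [ x ]) t)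
          ≡⟨ cong₂ (λ u e → head y * X - (head x * det (map tail u) - e)) (++-assoc as [ y ] t) yx≡-xy ⟩
        head y * X - (head x * Y - (- Z))
          ≡⟨ solve 5 (λ hx hy X Y Z → hy :* X :- (hx :* Y :- (:- Z)) := :- (hx :* Y :- (hy :* X :- Z)))
                     refl (head x) (head y) X Y Z ⟩
        - (head x * Y - (head y * X - Z))
          ≡⟨ cong (λ u → - (head x * Y - (head y * det (map tail u) - Z))) (sym (++-assoc as [ x ] t)) ⟩
        - (head x * Y - (head y * det (map tail ((as ++ [ x ]) ++ t)) - Z)) ∎
      where
      open ≡-Reasoning
      X = det (map tail (as ++ x ∷ t))
      Y = det (map tail (as ++ y ∷ t))
      Z = laplace ((as ++ [ x ]) ++ [ y ]) t
      yx≡-xy : laplace ((as ++ [ y ]) ++ [ x ]) t ≡ - Z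
      yx≡-xy = laplace-swap-done
        (subst₂ Swap (sym (++-assoc as [ x ] [ y ])) (sym (++-assoc as [ y ] [ x ])) (Swap-++ˡ as here)) t
    laplace-swap-rest as (there {x} {t} s) =
      trans (cong₂ (λ D e → head x * D - e) (det-swap (Swap-map tail (Swap-++ˡ as s)))
                                            (laplace-swap-rest (as ++ [ x ]) s))
            (negate-term (head x) (det (map tail (as ++ t))) (laplace (as ++ [ x ]) t))

  det-repeated-row : ∀ {d} (pre : List (Vector d)) r mid post → det (pre ++ r ∷ mid ++ r ∷ post) ≡ 0ℚ
  det-repeated-row pre r []        post = p≡-p⇒p≡0 (det-swap (Swap-++ˡ pre here))
  det-repeated-row pre r (m ∷ mid) post = begin
      det (pre ++ r ∷ m ∷ rest)            ≡⟨ sym (neg-involutive _) ⟩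
      - - det (pre ++ r ∷ m ∷ rest)        ≡⟨ cong -_ (sym (det-swap (Swap-++ˡ pre (here {a = r} {b = m})))) ⟩
      - det (pre ++ m ∷ r ∷ rest)          ≡⟨ cong (λ u → - det u) (sym (++-assoc pre [ m ] (r ∷ rest))) ⟩
      - det ((pre ++ [ m ]) ++ r ∷ rest)   ≡⟨ cong -_ (det-repeated-row (pre ++ [ m ]) r mid post) ⟩
      0ℚ                                   ∎
    where
    open ≡-Reasoning
    rest = mid ++ r ∷ post

  0≡0+c*0 : ∀ c → 0ℚ ≡ 0ℚ + c * 0ℚ
  0≡0+c*0 = solve 1 (λ c → con 0ℚ := con 0ℚ :+ c :* con 0ℚ) refl

  linear-in-minor : ∀ h Du Dv Eu Ev c → h * (Du + c * Dv) - (Eu + c * Ev) ≡ (h * Du - Eu) + c * (h * Dv - Ev)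
  linear-in-minor = solve 6 (λ h Du Dv Eu Ev c →
    h :* (Du :+ c :* Dv) :- (Eu :+ c :* Ev) := (h :* Du :- Eu) :+ c :* (h :* Dv :- Ev)) refl

  linear-in-head : ∀ hu hv D Eu Ev c → (hu + c * hv) * D - (Eu + c * Ev) ≡ (hu * D - Eu) + c * (hv * D - Ev)
  linear-in-head = solve 6 (λ hu hv D Eu Ev c →
    (hu :+ c :* hv) :* D :- (Eu :+ c :* Ev) := (hu :* D :- Eu) :+ c :* (hv :* D :- Ev)) refl

  private
    det-without-columns : ∀ (pre : List (Vector zero)) r post → det (pre ++ r ∷ post) ≡ 0ℚ
    det-without-columns []      r post = refl
    det-without-columns (_ ∷ _) r post = refl

    tails-split : ∀ {d} (pre : List (Vector (suc d))) l post X →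
                  map tail ((pre ++ l ∷ post) ++ X) ≡ map tail pre ++ tail l ∷ map tail (post ++ X)
    tails-split pre l post X = trans (cong (map tail) (++-assoc pre (l ∷ post) X)) (map-++ tail pre (l ∷ post ++ X))

    tails-split′ : ∀ {d} (as pre : List (Vector (suc d))) l post →
                   map tail (as ++ pre ++ l ∷ post) ≡ map tail (as ++ pre) ++ tail l ∷ map tail post
    tails-split′ as pre l post = trans (cong (map tail) (sym (++-assoc as pre (l ∷ post)))) (map-++ tail (as ++ pre) (l ∷ post))

  mutual
    det-linear-row : ∀ {d} (pre : List (Vector d)) l u v post c → (∀ k → l k ≡ u k + c * v k) →
                     det (pre ++ l ∷ post) ≡ det (pre ++ u ∷ post) + c * det (pre ++ v ∷ post)
    det-linear-row {zero} pre l u v post c l≗u+cv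
      rewrite det-without-columns pre l post | det-without-columns pre u post | det-without-columns pre v post
      = 0≡0+c*0 c
    det-linear-row {suc d} pre l u v post c l≗u+cv = laplace-linear-rest [] pre l u v post c l≗u+cv

    laplace-linear-done : ∀ {d} (pre : List (Vector (suc d))) l u v post c → (∀ k → l k ≡ u k + c * v k) →
                          ∀ rs → laplace (pre ++ l ∷ post) rs
                               ≡ laplace (pre ++ u ∷ post) rs + c * laplace (pre ++ v ∷ post) rs
    laplace-linear-done pre l u v post c l≗u+cv [] = 0≡0+c*0 c
    laplace-linear-done pre l u v post c l≗u+cv (x ∷ rs)
      rewrite tails-split pre l post rs | tails-split pre u post rs | tails-split pre v post rs
            | ++-assoc pre (l ∷ post) [ x ] | ++-assoc pre (u ∷ post) [ x ] | ++-assoc pre (v ∷ post) [ x ]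
            | det-linear-row (map tail pre) (tail l) (tail u) (tail v) (map tail (post ++ rs)) c (λ k → l≗u+cv (suc k))
            | laplace-linear-done pre l u v (post ++ [ x ]) c l≗u+cv rs
      = linear-in-minor (head x) _ _ _ _ c

    laplace-linear-rest : ∀ {d} (as pre : List (Vector (suc d))) l u v post c → (∀ k → l k ≡ u k + c * v k) →
                          laplace as (pre ++ l ∷ post)
                            ≡ laplace as (pre ++ u ∷ post) + c * laplace as (pre ++ v ∷ post)
    laplace-linear-rest as [] l u v post c l≗u+cv
      rewrite l≗u+cv zero | laplace-linear-done as l u v [] c l≗u+cv post
      = linear-in-head (u zero) (v zero) _ _ _ c
    laplace-linear-rest as (x ∷ pre) l u v post c l≗u+cv
      rewrite tails-split′ as pre l post | tails-split′ as pre u post | tails-split′ as pre v post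
            | det-linear-row (map tail (as ++ pre)) (tail l) (tail u) (tail v) (map tail post) c (λ k → l≗u+cv (suc k))
            | laplace-linear-rest (as ++ [ x ]) pre l u v post c l≗u+cv
      = linear-in-minor (head x) _ _ _ _ c

module DeterminantKernel where

  open import Data.Nat as ℕ using (ℕ; zero; suc)
  open import Data.Nat.Properties as NP using ()
  open import Data.Rational as ℚ using (ℚ; 0ℚ; 1ℚ; _+_; _*_; _-_; -_)
  open import Data.Rational.Properties as QP using ()
  open import Data.Rational.Solver using (module +-*-Solver)
  open import Data.Fin using (Fin; zero; suc)
  open import Data.Vec.Functional using (head; tail)
  open import Data.List using (List; []; _∷_; _++_; map; [_]; length)
  open import Data.List.Properties using (++-assoc; length-++; length-map)
  open import Data.List.Relation.Unary.All as All using (All; []; _∷_)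
  open import Data.List.Relation.Unary.All.Properties as All using ()
  open import Data.Product using (Σ; _,_; _×_; proj₁; proj₂)
  open import Data.Sum using (_⊎_; inj₁; inj₂)
  open import Relation.Binary.PropositionalEquality hiding ([_])
  open import Relation.Nullary using (yes; no)
  open import Data.Empty using (⊥; ⊥-elim)
  open import Defs using (Vector; sumFin)
  open RationalFacts
  open FinSums
  open Determinant
  open +-*-Solver

  Nonzero : ∀ {d} → Vector d → Set
  Nonzero {d} v = Σ (Fin d) λ j → v j ≢ 0ℚ

  InKernel : ∀ {d} → List (Vector d) → Vector d → Set
  InKernel rs v = All (λ r → r ·ᵥ v ≡ 0ℚ) rs

  TrivialKernel : ∀ {d} → List (Vector d) → Set
  TrivialKernel rs = ∀ z → InKernel rs z → ∀ j → z j ≡ 0ℚ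

  nonzero? : ∀ {d} (v : Vector d) → Nonzero v ⊎ (∀ j → v j ≡ 0ℚ)
  nonzero? {zero}  v = inj₂ (λ ())
  nonzero? {suc d} v with v zero QP.≟ 0ℚ | nonzero? (tail v)
  ... | no v₀≢0 | _                = inj₁ (zero , v₀≢0)
  ... | yes _   | inj₁ (j , vⱼ≢0) = inj₁ (suc j , vⱼ≢0)
  ... | yes v₀≡0 | inj₂ tail≡0   = inj₂ λ { zero → v₀≡0 ; (suc j) → tail≡0 j }

  HeadZero : ∀ {d} → Vector (suc d) → Set
  HeadZero r = head r ≡ 0ℚ

  laplace-headZero : ∀ {d} (as rs : List (Vector (suc d))) → All HeadZero rs → laplace as rs ≡ 0ℚ
  laplace-headZero as []       []       = refl
  laplace-headZero as (r ∷ rs) (h ∷ hs) rewrite h | laplace-headZero (as ++ [ r ]) rs hs =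
    solve 1 (λ D → con 0ℚ :* D :- con 0ℚ := con 0ℚ) refl (det (map tail (as ++ rs)))

  sign : ℕ → ℚ
  sign zero    = 1ℚ
  sign (suc k) = - sign k

  sign≢0 : ∀ k → sign k ≢ 0ℚ
  sign≢0 zero    ()
  sign≢0 (suc k) eq = sign≢0 k (trans (sym (neg-involutive (sign k))) (cong -_ eq))

  laplace-pivot : ∀ {d} (as xs : List (Vector (suc d))) p ys → All HeadZero xs → All HeadZero ys →
                  laplace as (xs ++ p ∷ ys) ≡ sign (length xs) * (head p * det (map tail (as ++ xs ++ ys)))
  laplace-pivot as [] p ys hxs hys rewrite laplace-headZero (as ++ [ p ]) ys hys =
    solve 1 (λ X → X :- con 0ℚ := con 1ℚ :* X) refl (head p * det (map tail (as ++ ys)))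
  laplace-pivot as (x ∷ xs) p ys (hx ∷ hxs) hys
    rewrite hx | laplace-pivot (as ++ [ x ]) xs p ys hxs hys | ++-assoc as [ x ] (xs ++ ys) =
    solve 3 (λ D s Y → con 0ℚ :* D :- s :* Y := (:- s) :* Y) refl
      (det (map tail (as ++ xs ++ p ∷ ys))) (sign (length xs)) (head p * det (map tail (as ++ x ∷ xs ++ ys)))

  eliminate : ∀ {d} → Vector (suc d) → Vector (suc d) → Vector (suc d)
  eliminate p r k = r k - (head r * inv (head p)) * p k

  eliminate-headZero : ∀ {d} (p r : Vector (suc d)) → head p ≢ 0ℚ → HeadZero (eliminate p r)
  eliminate-headZero p r p₀≢0 = begin
      head r - (head r * inv (head p)) * head p   ≡⟨ cong (λ z → head r - z) (QP.*-assoc (head r) (inv (head p)) (head p)) ⟩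
      head r - head r * (inv (head p) * head p)   ≡⟨ cong (λ z → head r - head r * z) (inv-inverseˡ (head p) p₀≢0) ⟩
      head r - head r * 1ℚ                        ≡⟨ solve 1 (λ a → a :- a :* con 1ℚ := con 0ℚ) refl (head r) ⟩
      0ℚ                                          ∎
    where open ≡-Reasoning

  eliminate-·ᵥ : ∀ {d} (p r v : Vector (suc d)) → eliminate p r ·ᵥ v ≡ r ·ᵥ v - (head r * inv (head p)) * (p ·ᵥ v)
  eliminate-·ᵥ p r v = begin
      sumFin (λ j → (r j - μ * p j) * v j)
        ≡⟨ sumFin-cong (λ j → solve 4 (λ a m b c → (a :- m :* b) :* c := a :* c :- m :* (b :* c)) refl (r j) μ (p j) (v j)) ⟩
      sumFin (λ j → r j * v j - μ * (p j * v j))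
        ≡⟨ sumFin-- (λ j → r j * v j) (λ j → μ * (p j * v j)) ⟩
      r ·ᵥ v - sumFin (λ j → μ * (p j * v j))
        ≡⟨ cong (λ z → r ·ᵥ v - z) (sym (*-distribˡ-sumFin μ (λ j → p j * v j))) ⟩
      r ·ᵥ v - μ * (p ·ᵥ v) ∎
    where
    open ≡-Reasoning
    μ = head r * inv (head p)

  eliminate-linear : ∀ {d} (p r : Vector (suc d)) k → eliminate p r k ≡ r k + (- (head r * inv (head p))) * p k
  eliminate-linear p r k = solve 3 (λ a m b → a :- m :* b := a :+ (:- m) :* b) refl (r k) (head r * inv (head p)) (p k)

  det-eliminate : ∀ {d} (pre post : List (Vector (suc d))) p r → det (pre ++ p ∷ post) ≡ 0ℚ →
                  det (pre ++ eliminate p r ∷ post) ≡ det (pre ++ r ∷ post)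
  det-eliminate pre post p r det≡0 = begin
      det (pre ++ eliminate p r ∷ post)
        ≡⟨ det-linear-row pre (eliminate p r) r p post c (eliminate-linear p r) ⟩
      det (pre ++ r ∷ post) + c * det (pre ++ p ∷ post)
        ≡⟨ cong (λ z → det (pre ++ r ∷ post) + c * z) det≡0 ⟩
      det (pre ++ r ∷ post) + c * 0ℚ
        ≡⟨ solve 2 (λ a c → a :+ c :* con 0ℚ := a) refl (det (pre ++ r ∷ post)) c ⟩
      det (pre ++ r ∷ post) ∎
    where
    open ≡-Reasoning
    c = - (head r * inv (head p))

  det-eliminate-before : ∀ {d} (as bs : List (Vector (suc d))) p cs →
                         det (as ++ map (eliminate p) bs ++ p ∷ cs) ≡ det (as ++ bs ++ p ∷ cs)
  det-eliminate-before as []       p cs = refl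
  det-eliminate-before as (b ∷ bs) p cs = begin
      det (as ++ eliminate p b ∷ map (eliminate p) bs ++ p ∷ cs)
        ≡⟨ det-eliminate as _ p b (det-repeated-row as p (map (eliminate p) bs) cs) ⟩
      det (as ++ b ∷ map (eliminate p) bs ++ p ∷ cs)
        ≡⟨ cong det (sym (++-assoc as [ b ] _)) ⟩
      det ((as ++ [ b ]) ++ map (eliminate p) bs ++ p ∷ cs)
        ≡⟨ det-eliminate-before (as ++ [ b ]) bs p cs ⟩
      det ((as ++ [ b ]) ++ bs ++ p ∷ cs)
        ≡⟨ cong det (++-assoc as [ b ] _) ⟩
      det (as ++ b ∷ bs ++ p ∷ cs) ∎
    where open ≡-Reasoning

  det-eliminate-after : ∀ {d} (as₁ as₂ : List (Vector (suc d))) p bs →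
                        det ((as₁ ++ p ∷ as₂) ++ map (eliminate p) bs) ≡ det ((as₁ ++ p ∷ as₂) ++ bs)
  det-eliminate-after as₁ as₂ p []       = refl
  det-eliminate-after as₁ as₂ p (b ∷ bs) = begin
      det ((as₁ ++ p ∷ as₂) ++ eliminate p b ∷ map (eliminate p) bs)
        ≡⟨ det-eliminate (as₁ ++ p ∷ as₂) _ p b
             (trans (cong det (++-assoc as₁ (p ∷ as₂) _)) (det-repeated-row as₁ p as₂ _)) ⟩
      det ((as₁ ++ p ∷ as₂) ++ b ∷ map (eliminate p) bs)
        ≡⟨ cong det (shift (map (eliminate p) bs)) ⟩
      det ((as₁ ++ p ∷ (as₂ ++ [ b ])) ++ map (eliminate p) bs)
        ≡⟨ det-eliminate-after as₁ (as₂ ++ [ b ]) p bs ⟩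
      det ((as₁ ++ p ∷ (as₂ ++ [ b ])) ++ bs)
        ≡⟨ cong det (sym (shift bs)) ⟩
      det ((as₁ ++ p ∷ as₂) ++ b ∷ bs) ∎
    where
    open ≡-Reasoning
    shift : ∀ X → (as₁ ++ p ∷ as₂) ++ b ∷ X ≡ (as₁ ++ p ∷ (as₂ ++ [ b ])) ++ X
    shift X = trans (++-assoc as₁ (p ∷ as₂) (b ∷ X))
             (trans (cong (λ z → as₁ ++ p ∷ z) (sym (++-assoc as₂ [ b ] X)))
                    (sym (++-assoc as₁ (p ∷ as₂ ++ [ b ]) X)))

  det-eliminate-around : ∀ {d} (xs : List (Vector (suc d))) p ys →
                         det (map (eliminate p) xs ++ p ∷ map (eliminate p) ys) ≡ det (xs ++ p ∷ ys)
  det-eliminate-around xs p ys = begin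
      det (map (eliminate p) xs ++ p ∷ map (eliminate p) ys) ≡⟨ det-eliminate-before [] xs p _ ⟩
      det (xs ++ p ∷ map (eliminate p) ys)                   ≡⟨ cong det (sym (++-assoc xs [ p ] _)) ⟩
      det ((xs ++ [ p ]) ++ map (eliminate p) ys)            ≡⟨ det-eliminate-after xs [] p ys ⟩
      det ((xs ++ [ p ]) ++ ys)                              ≡⟨ cong det (++-assoc xs [ p ] ys) ⟩
      det (xs ++ p ∷ ys)                                     ∎
    where open ≡-Reasoning

  record Pivot {d} (rs : List (Vector (suc d))) : Set where
    field
      above : List (Vector (suc d))
      pivot : Vector (suc d)
      below : List (Vector (suc d))
      split : rs ≡ above ++ pivot ∷ below
      pivot₀≢0 : head pivot ≢ 0ℚ

    minor : List (Vector d)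
    minor = map tail (map (eliminate pivot) above ++ map (eliminate pivot) below)

  findPivot : ∀ {d} (rs : List (Vector (suc d))) → All HeadZero rs ⊎ Pivot rs
  findPivot [] = inj₁ []
  findPivot (r ∷ rs) with head r QP.≟ 0ℚ | findPivot rs
  ... | no r₀≢0 | _ = inj₂ (record { above = [] ; pivot = r ; below = rs ; split = refl ; pivot₀≢0 = r₀≢0 })
  ... | yes r₀≡0 | inj₁ allZero = inj₁ (r₀≡0 ∷ allZero)
  ... | yes r₀≡0 | inj₂ pv = inj₂ (record
    { above = r ∷ Pivot.above pv ; pivot = Pivot.pivot pv ; below = Pivot.below pv
    ; split = cong (r ∷_) (Pivot.split pv) ; pivot₀≢0 = Pivot.pivot₀≢0 pv })

  det-pivot : ∀ {d} (rs : List (Vector (suc d))) (pv : Pivot rs) → let open Pivot pv in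
              det rs ≡ sign (length above) * (head pivot * det minor)
  det-pivot rs pv = begin
      det rs
        ≡⟨ cong det split ⟩
      det (above ++ pivot ∷ below)
        ≡⟨ sym (det-eliminate-around above pivot below) ⟩
      det (map (eliminate pivot) above ++ pivot ∷ map (eliminate pivot) below)
        ≡⟨ laplace-pivot [] _ pivot _ (cleared above) (cleared below) ⟩
      sign (length (map (eliminate pivot) above)) * (head pivot * det minor)
        ≡⟨ cong (λ k → sign k * (head pivot * det minor)) (length-map (eliminate pivot) above) ⟩
      sign (length above) * (head pivot * det minor) ∎
    where
    open ≡-Reasoning
    open Pivot pv
    cleared : ∀ xs → All HeadZero (map (eliminate pivot) xs)
    cleared xs = All.map⁺ (All.tabulate (λ {r} _ → eliminate-headZero pivot r pivot₀≢0))

  length-minor : ∀ {d} {rs : List (Vector (suc d))} (pv : Pivot rs) → length rs ≡ suc d → length (Pivot.minor pv) ≡ d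
  length-minor {d} {rs} pv len = begin
      length (map tail (map (eliminate pivot) above ++ map (eliminate pivot) below))
        ≡⟨ length-map tail (map (eliminate pivot) above ++ _) ⟩
      length (map (eliminate pivot) above ++ map (eliminate pivot) below)
        ≡⟨ length-++ (map (eliminate pivot) above) ⟩
      length (map (eliminate pivot) above) ℕ.+ length (map (eliminate pivot) below)
        ≡⟨ cong₂ ℕ._+_ (length-map (eliminate pivot) above) (length-map (eliminate pivot) below) ⟩
      length above ℕ.+ length below
        ≡⟨ NP.suc-injective (trans (sym (NP.+-suc (length above) (length below)))
                                   (trans (sym (length-++ above)) (trans (cong length (sym split)) len))) ⟩
      d ∎
    where
    open ≡-Reasoning
    open Pivot pv

  module _ {d} (p r v : Vector (suc d)) where
    private μ = head r * inv (head p)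

    eliminate-kernel⇒kernel : p ·ᵥ v ≡ 0ℚ → eliminate p r ·ᵥ v ≡ 0ℚ → r ·ᵥ v ≡ 0ℚ
    eliminate-kernel⇒kernel pv≡0 ev≡0 = begin
        r ·ᵥ v                                 ≡⟨ solve 3 (λ a m b → a := (a :- m :* b) :+ m :* b) refl (r ·ᵥ v) μ (p ·ᵥ v) ⟩
        (r ·ᵥ v - μ * (p ·ᵥ v)) + μ * (p ·ᵥ v) ≡⟨ cong₂ (λ a b → a + μ * b) (trans (sym (eliminate-·ᵥ p r v)) ev≡0) pv≡0 ⟩
        0ℚ + μ * 0ℚ                            ≡⟨ solve 1 (λ m → con 0ℚ :+ m :* con 0ℚ := con 0ℚ) refl μ ⟩
        0ℚ                                     ∎
      where open ≡-Reasoning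

    kernel⇒eliminate-kernel : p ·ᵥ v ≡ 0ℚ → r ·ᵥ v ≡ 0ℚ → eliminate p r ·ᵥ v ≡ 0ℚ
    kernel⇒eliminate-kernel pv≡0 rv≡0 = begin
        eliminate p r ·ᵥ v          ≡⟨ eliminate-·ᵥ p r v ⟩
        r ·ᵥ v - μ * (p ·ᵥ v)       ≡⟨ cong₂ (λ a b → a - μ * b) rv≡0 pv≡0 ⟩
        0ℚ - μ * 0ℚ                 ≡⟨ solve 1 (λ m → con 0ℚ :- m :* con 0ℚ := con 0ℚ) refl μ ⟩
        0ℚ                          ∎
      where open ≡-Reasoning

  module _ {d} {rs : List (Vector (suc d))} (pv : Pivot rs) where
    open Pivot pv

    det≡0⇒minor≡0 : det rs ≡ 0ℚ → det minor ≡ 0ℚ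
    det≡0⇒minor≡0 det≡0 with det minor QP.≟ 0ℚ
    ... | yes minor≡0 = minor≡0
    ... | no  minor≢0 = ⊥-elim (*-≢0 (sign≢0 (length above)) (*-≢0 pivot₀≢0 minor≢0) (trans (sym (det-pivot rs pv)) det≡0))

    -- The first coordinate is the unique value making the pivot row vanish.
    liftKernel : Vector d → Vector (suc d)
    liftKernel v′ zero    = - (tail pivot ·ᵥ v′) * inv (head pivot)
    liftKernel v′ (suc j) = v′ j

    liftKernel-pivot : ∀ v′ → pivot ·ᵥ liftKernel v′ ≡ 0ℚ
    liftKernel-pivot v′ = begin
        head pivot * (- t * inv (head pivot)) + t ≡⟨ solve 3 (λ h t i → h :* (:- t :* i) :+ t := t :- t :* (i :* h)) refl (head pivot) t (inv (head pivot)) ⟩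
        t - t * (inv (head pivot) * head pivot)   ≡⟨ cong (λ z → t - t * z) (inv-inverseˡ (head pivot) pivot₀≢0) ⟩
        t - t * 1ℚ                                ≡⟨ solve 1 (λ t → t :- t :* con 1ℚ := con 0ℚ) refl t ⟩
        0ℚ                                        ∎
      where
      open ≡-Reasoning
      t = tail pivot ·ᵥ v′

    liftKernel-kernel : ∀ v′ → InKernel minor v′ → InKernel rs (liftKernel v′)
    liftKernel-kernel v′ ker = subst (λ rs → InKernel rs (liftKernel v′)) (sym split)
        (All.++⁺ (All.map (λ {r} → lift r) (All.map⁻ (proj₁ kers)))
                 (liftKernel-pivot v′ ∷ All.map (λ {r} → lift r) (All.map⁻ (proj₂ kers))))
      where
      kers = All.++⁻ (map (eliminate pivot) above) (All.map⁻ ker)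
      lift : ∀ r → tail (eliminate pivot r) ·ᵥ v′ ≡ 0ℚ → r ·ᵥ liftKernel v′ ≡ 0ℚ
      lift r h = eliminate-kernel⇒kernel pivot r (liftKernel v′) (liftKernel-pivot v′)
        (trans (cong₂ (λ a b → a * liftKernel v′ zero + b) (eliminate-headZero pivot r pivot₀≢0) h)
               (solve 1 (λ x → con 0ℚ :* x :+ con 0ℚ := con 0ℚ) refl (liftKernel v′ zero)))

    restrictKernel : ∀ v → InKernel rs v → InKernel minor (tail v)
    restrictKernel v ker = All.map⁺ (All.++⁺ (All.map⁺ (All.map (λ {r} → restrict r) (proj₁ kers)))
                                             (All.map⁺ (All.map (λ {r} → restrict r) (All.tail (proj₂ kers)))))
      where
      kers = All.++⁻ above (subst (λ rs → InKernel rs v) split ker)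
      pivot-ker : pivot ·ᵥ v ≡ 0ℚ
      pivot-ker = All.head (proj₂ kers)
      restrict : ∀ r → r ·ᵥ v ≡ 0ℚ → tail (eliminate pivot r) ·ᵥ tail v ≡ 0ℚ
      restrict r rv≡0 = begin
          tail (eliminate pivot r) ·ᵥ tail v
            ≡⟨ solve 2 (λ a b → b := a :* con 0ℚ :+ b) refl (v zero) _ ⟩
          v zero * 0ℚ + tail (eliminate pivot r) ·ᵥ tail v
            ≡⟨ cong (λ z → v zero * z + tail (eliminate pivot r) ·ᵥ tail v) (sym (eliminate-headZero pivot r pivot₀≢0)) ⟩
          v zero * head (eliminate pivot r) + tail (eliminate pivot r) ·ᵥ tail v
            ≡⟨ cong (_+ tail (eliminate pivot r) ·ᵥ tail v) (QP.*-comm (v zero) _) ⟩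
          eliminate pivot r ·ᵥ v
            ≡⟨ kernel⇒eliminate-kernel pivot r v pivot-ker rv≡0 ⟩
          0ℚ ∎
        where open ≡-Reasoning

    restrictKernel-nonzero : ∀ v → Nonzero v → InKernel rs v → Nonzero (tail v)
    restrictKernel-nonzero v nz ker with nonzero? (tail v)
    ... | inj₁ nz′ = nz′
    ... | inj₂ tail≡0 = ⊥-elim (v₀≢0 nz)
      where
      pivot-ker = All.head (proj₂ (All.++⁻ above (subst (λ rs → InKernel rs v) split ker)))
      v₀≢0 : Nonzero v → ⊥
      v₀≢0 (suc j , vⱼ≢0) = vⱼ≢0 (tail≡0 j)
      v₀≢0 (zero , v₀≢0) = *-≢0 pivot₀≢0 v₀≢0 (begin
          head pivot * v zero                                ≡⟨ sym (QP.+-identityʳ _) ⟩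
          head pivot * v zero + 0ℚ                           ≡⟨ cong (head pivot * v zero +_) (sym (sumFin-zero _ (λ j → trans (cong (tail pivot j *_) (tail≡0 j)) (QP.*-zeroʳ (tail pivot j))))) ⟩
          pivot ·ᵥ v                                         ≡⟨ pivot-ker ⟩
          0ℚ                                                 ∎)
        where open ≡-Reasoning

  det≡0⇒kernel : ∀ {d} (rs : List (Vector d)) → length rs ≡ d → det rs ≡ 0ℚ → Σ (Vector d) λ v → Nonzero v × InKernel rs v
  det≡0⇒kernel {zero}  []  len det≡0 = ⊥-elim (QP.1≢0 det≡0)
  det≡0⇒kernel {suc d} rs len det≡0 with findPivot rs
  ... | inj₁ allZero = (λ j → δ j zero) , (zero , λ ()) , All.map (λ {r} r₀≡0 → trans (sumFin-δ r zero) r₀≡0) allZero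
  ... | inj₂ pv with det≡0⇒kernel (Pivot.minor pv) (length-minor pv len) (det≡0⇒minor≡0 pv det≡0)
  ...   | v′ , (j , v′ⱼ≢0) , ker = liftKernel pv v′ , (suc j , v′ⱼ≢0) , liftKernel-kernel pv v′ ker

  kernel⇒det≡0 : ∀ {d} (rs : List (Vector d)) (v : Vector d) → Nonzero v → InKernel rs v → det rs ≡ 0ℚ
  kernel⇒det≡0 {zero}  rs v (() , _) ker
  kernel⇒det≡0 {suc d} rs v nz ker with findPivot rs
  ... | inj₁ allZero = laplace-headZero [] rs allZero
  ... | inj₂ pv = begin
      det rs                                                      ≡⟨ det-pivot rs pv ⟩
      sign (length above) * (head pivot * det minor)              ≡⟨ cong (λ z → sign (length above) * (head pivot * z)) minor≡0 ⟩
      sign (length above) * (head pivot * 0ℚ)                     ≡⟨ solve 2 (λ s h → s :* (h :* con 0ℚ) := con 0ℚ) refl (sign (length above)) (head pivot) ⟩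
      0ℚ                                                          ∎
    where
    open ≡-Reasoning
    open Pivot pv
    minor≡0 : det minor ≡ 0ℚ
    minor≡0 = kernel⇒det≡0 minor (tail v) (restrictKernel-nonzero pv v nz ker) (restrictKernel pv v ker)

module CramersRule where

  open import Data.Nat using (zero; suc)
  open import Data.Rational as ℚ using (ℚ; 0ℚ; 1ℚ; _+_; _*_; _-_; -_)
  open import Data.Rational.Properties as QP using ()
  open import Data.Rational.Solver using (module +-*-Solver)
  open import Data.Fin using (Fin; zero; suc)
  open import Data.Fin.Properties using (suc-injective)
  open import Data.Vec.Functional using (tail; updateAt)
  open import Data.Vec.Functional.Properties using (updateAt-updates; updateAt-minimal)
  open import Data.List using (List; []; _∷_; _++_; map; [_]; length)
  open import Data.List.Relation.Binary.Pointwise using ([]; _∷_)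
  open import Data.List.Relation.Unary.All using ([]; _∷_)
  open import Data.Product using (_,_; _×_; proj₁; proj₂)
  open import Function using (const)
  open import Relation.Binary.PropositionalEquality hiding ([_])
  open import Defs using (Vector)
  open RationalFacts
  open FinSums
  open Determinant
  open DeterminantKernel
  open +-*-Solver

  setAt : ∀ {d} → Fin d → ℚ → Vector d → Vector d
  setAt j b r = updateAt r j (const b)

  ·ᵥ-setAt : ∀ {d} (j : Fin d) a b (r v : Vector d) → setAt j a r ·ᵥ setAt j b v ≡ r ·ᵥ v - r j * v j + a * b
  ·ᵥ-setAt zero a b r v =
    solve 4 (λ a b x s → a :* b :+ s := (x :+ s) :- x :+ a :* b) refl a b (r zero * v zero) (tail r ·ᵥ tail v)
  ·ᵥ-setAt (suc j) a b r v =
    trans (cong (r zero * v zero +_) (·ᵥ-setAt j a b (tail r) (tail v)))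
          (solve 4 (λ x s y ab → x :+ (s :- y :+ ab) := (x :+ s) :- y :+ ab) refl
                 (r zero * v zero) (tail r ·ᵥ tail v) (r (suc j) * v (suc j)) (a * b))

  ColumnSplit : ∀ {d} → Fin d → ℚ → Vector d → Vector d → Vector d → Set
  ColumnSplit j c l u v = (∀ k → k ≢ j → l k ≡ u k × l k ≡ v k) × l j ≡ u j + c * v j

  data ColumnSplits {d} (j : Fin d) (c : ℚ) : List (Vector d) → List (Vector d) → List (Vector d) → Set where
    []  : ColumnSplits j c [] [] []
    _∷_ : ∀ {l u v ls us vs} → ColumnSplit j c l u v → ColumnSplits j c ls us vs →
          ColumnSplits j c (l ∷ ls) (u ∷ us) (v ∷ vs)

  ColumnSplits-++ : ∀ {d} {j : Fin d} {c as as′ as″ ls us vs} → ColumnSplits j c as as′ as″ →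
                    ColumnSplits j c ls us vs → ColumnSplits j c (as ++ ls) (as′ ++ us) (as″ ++ vs)
  ColumnSplits-++ []         s = s
  ColumnSplits-++ (x ∷ sp)   s = x ∷ ColumnSplits-++ sp s

  ColumnSplits-tail : ∀ {d} {j : Fin d} {c ls us vs} → ColumnSplits (suc j) c ls us vs →
                      ColumnSplits j c (map tail ls) (map tail us) (map tail vs)
  ColumnSplits-tail []              = []
  ColumnSplits-tail ((off , on) ∷ s) = ((λ k k≢j → off (suc k) (λ eq → k≢j (suc-injective eq))) , on) ∷ ColumnSplits-tail s

  ColumnSplits-zero⇒tails₁ : ∀ {d} {c} {ls us vs : List (Vector (suc d))} → ColumnSplits zero c ls us vs →
                             RowsEq (map tail ls) (map tail us)
  ColumnSplits-zero⇒tails₁ []              = []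
  ColumnSplits-zero⇒tails₁ ((off , _) ∷ s) = (λ k → proj₁ (off (suc k) (λ ()))) ∷ ColumnSplits-zero⇒tails₁ s

  ColumnSplits-zero⇒tails₂ : ∀ {d} {c} {ls us vs : List (Vector (suc d))} → ColumnSplits zero c ls us vs →
                             RowsEq (map tail ls) (map tail vs)
  ColumnSplits-zero⇒tails₂ []              = []
  ColumnSplits-zero⇒tails₂ ((off , _) ∷ s) = (λ k → proj₂ (off (suc k) (λ ()))) ∷ ColumnSplits-zero⇒tails₂ s

  mutual
    det-linear-column : ∀ {d} (j : Fin d) c {ls us vs} → ColumnSplits j c ls us vs → det ls ≡ det us + c * det vs
    det-linear-column {suc d} j c s = laplace-linear-column j c [] s

    laplace-linear-column : ∀ {d} (j : Fin (suc d)) c {as as′ as″ ls us vs} → ColumnSplits j c as as′ as″ →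
                            ColumnSplits j c ls us vs → laplace as ls ≡ laplace as′ us + c * laplace as″ vs
    laplace-linear-column j c sa [] = 0≡0+c*0 c
    laplace-linear-column zero c {ls = l ∷ ls} {u ∷ us} {v ∷ vs} sa ((off , on) ∷ s)
      rewrite on | sym (det-cong (ColumnSplits-zero⇒tails₂ (ColumnSplits-++ sa s)))
            | det-cong (ColumnSplits-zero⇒tails₁ (ColumnSplits-++ sa s))
            | laplace-linear-column zero c (ColumnSplits-++ sa ((off , on) ∷ [])) s
      = linear-in-head (u zero) (v zero) _ _ _ c
    laplace-linear-column (suc j) c {ls = l ∷ ls} {u ∷ us} {v ∷ vs} sa ((off , on) ∷ s)
      rewrite det-linear-column j c (ColumnSplits-tail (ColumnSplits-++ sa s))
            | laplace-linear-column (suc j) c (ColumnSplits-++ sa ((off , on) ∷ [])) s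
            | proj₁ (off zero (λ ())) | sym (trans (sym (proj₁ (off zero (λ ())))) (proj₂ (off zero (λ ()))))
      = linear-in-minor (u zero) _ _ _ _ c

  -- Splitting column j of each row as (r ·ᵥ y - yⱼ rⱼ) + yⱼ rⱼ, the first summand gives a
  -- singular matrix, with kernel vector y[j := -1].
  module _ {d} (j : Fin d) (y : Vector d) where

    private
      withRHS withDefect : Vector d → Vector d
      withRHS    r = setAt j (r ·ᵥ y) r
      withDefect r = setAt j (r ·ᵥ y - y j * r j) r

      splits : ∀ rs → ColumnSplits j (y j) (map withRHS rs) (map withDefect rs) rs
      splits []       = []
      splits (r ∷ rs) = ((λ k k≢j → trans (updateAt-minimal k j r k≢j) (sym (updateAt-minimal k j r k≢j)) , updateAt-minimal k j r k≢j)
                        , trans (updateAt-updates j r)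
                            (trans (solve 3 (λ a b c → a := (a :- b :* c) :+ b :* c) refl (r ·ᵥ y) (y j) (r j))
                                   (cong (_+ y j * r j) (sym (updateAt-updates j r))))) ∷ splits rs

      defectKernel : ∀ rs → InKernel (map withDefect rs) (setAt j (- 1ℚ) y)
      defectKernel []       = []
      defectKernel (r ∷ rs) = trans (·ᵥ-setAt j _ _ r y)
        (solve 3 (λ s a b → s :- a :* b :+ (s :- b :* a) :* (:- con 1ℚ) := con 0ℚ) refl (r ·ᵥ y) (r j) (y j))
        ∷ defectKernel rs

      -1≢0 : setAt j (- 1ℚ) y j ≢ 0ℚ
      -1≢0 eq = QP.1≢0 (trans (sym (neg-involutive 1ℚ)) (cong -_ (trans (sym (updateAt-updates j y)) eq)))

    cramer : ∀ (rs : List (Vector d)) → det (map (λ r → setAt j (r ·ᵥ y) r) rs) ≡ y j * det rs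
    cramer rs = begin
        det (map withRHS rs)                ≡⟨ det-linear-column j (y j) (splits rs) ⟩
        det (map withDefect rs) + y j * det rs
          ≡⟨ cong (_+ y j * det rs) (kernel⇒det≡0 (map withDefect rs) _ (j , -1≢0) (defectKernel rs)) ⟩
        0ℚ + y j * det rs                   ≡⟨ QP.+-identityˡ _ ⟩
        y j * det rs                        ∎
      where open ≡-Reasoning

  det≢0 : ∀ {d} (rs : List (Vector d)) → length rs ≡ d → TrivialKernel rs → det rs ≢ 0ℚ
  det≢0 rs len trivial det≡0 with det≡0⇒kernel rs len det≡0
  ... | v , (j , vⱼ≢0) , ker = vⱼ≢0 (trivial v ker j)

  cramer-solve : ∀ {d} (rs : List (Vector d)) → length rs ≡ d → TrivialKernel rs →
                 ∀ y j → y j ≡ det (map (λ r → setAt j (r ·ᵥ y) r) rs) * inv (det rs)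
  cramer-solve rs len trivial y j = y≡x*z⇒x≡y*inv[z] (det≢0 rs len trivial) (cramer j y rs)

module KernelBasis where

  open import Data.Nat using (ℕ; zero; suc)
  open import Data.Rational as ℚ using (ℚ; 0ℚ; 1ℚ; _+_; _*_; _-_; -_)
  open import Data.Rational.Properties as QP using ()
  open import Data.Rational.Solver using (module +-*-Solver)
  open import Data.Fin using (Fin; zero; suc)
  open import Data.List using (List; _∷_)
  open import Data.List.Relation.Unary.All using (_∷_)
  open import Data.Product using (Σ; _,_; proj₁; proj₂)
  open import Relation.Binary.PropositionalEquality
  open import Defs using (Vector; sumFin)
  open RationalFacts
  open FinSums
  open DeterminantKernel using (InKernel)
  open +-*-Solver

  module _ {n k : ℕ} where

    HasPivots : (Fin k → Vector n) → (Fin k → Fin n) → Set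
    HasPivots K piv = ∀ i j → K i (piv j) ≡ δ i j

    Spans : List (Vector n) → (Fin k → Vector n) → Set
    Spans rs K = ∀ z → InKernel rs z → Σ (Fin k → ℚ) λ l → ∀ j → z j ≡ sumFin (λ i → l i * K i j)

  -- Projects K 1, …, K k onto the hyperplane a ⊥ along K 0.
  reduce : ∀ {n k} → Vector n → (Fin (suc k) → Vector n) → Fin k → Vector n
  reduce a K i j = K (suc i) j - ((a ·ᵥ K (suc i)) * inv (a ·ᵥ K zero)) * K zero j

  module _ {n k} (a : Vector n) (K : Fin (suc k) → Vector n) where

    private
      μ : Fin k → ℚ
      μ i = (a ·ᵥ K (suc i)) * inv (a ·ᵥ K zero)

    reduce-orthogonal : a ·ᵥ K zero ≢ 0ℚ → ∀ i → a ·ᵥ reduce a K i ≡ 0ℚ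
    reduce-orthogonal aK₀≢0 i = begin
        a ·ᵥ reduce a K i                          ≡⟨ ·ᵥ-linear- a (K (suc i)) (K zero) (μ i) ⟩
        X - (X * inv Y) * Y                        ≡⟨ cong (λ z → X - z) (QP.*-assoc X (inv Y) Y) ⟩
        X - X * (inv Y * Y)                        ≡⟨ cong (λ z → X - X * z) (inv-inverseˡ Y aK₀≢0) ⟩
        X - X * 1ℚ                                 ≡⟨ solve 1 (λ x → x :- x :* con 1ℚ := con 0ℚ) refl X ⟩
        0ℚ                                         ∎
      where
      open ≡-Reasoning
      X = a ·ᵥ K (suc i)
      Y = a ·ᵥ K zero

    reduce-kernel : ∀ r → (∀ i → r ·ᵥ K i ≡ 0ℚ) → ∀ i → r ·ᵥ reduce a K i ≡ 0ℚ
    reduce-kernel r rK≡0 i = begin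
        r ·ᵥ reduce a K i                          ≡⟨ ·ᵥ-linear- r (K (suc i)) (K zero) (μ i) ⟩
        r ·ᵥ K (suc i) - μ i * (r ·ᵥ K zero)       ≡⟨ cong₂ (λ u w → u - μ i * w) (rK≡0 (suc i)) (rK≡0 zero) ⟩
        0ℚ - μ i * 0ℚ                              ≡⟨ solve 1 (λ m → con 0ℚ :- m :* con 0ℚ := con 0ℚ) refl (μ i) ⟩
        0ℚ                                         ∎
      where open ≡-Reasoning

    reduce-pivots : ∀ {piv} → HasPivots K piv → HasPivots (reduce a K) (λ j → piv (suc j))
    reduce-pivots {piv} pivots i j rewrite pivots (suc i) (suc j) | pivots zero (suc j) =
      solve 2 (λ x m → x :- m :* con 0ℚ := x) refl (δ i j) (μ i)

    -- A kernel vector z = Σ lᵢ Kᵢ orthogonal to a has l₀ = -(Σ lᵢ₊₁ μᵢ), which is exactly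
    -- the coefficient of K 0 in Σ lᵢ₊₁ (reduce a K i).
    reduce-spans : ∀ {rs} → a ·ᵥ K zero ≢ 0ℚ → Spans rs K → Spans (a ∷ rs) (reduce a K)
    reduce-spans {rs} aK₀≢0 spans z (az≡0 ∷ ker) = (λ i → l (suc i)) , z≡
      where
      l = proj₁ (spans z ker)
      z≗ = proj₂ (spans z ker)
      Y = a ·ᵥ K zero
      S = sumFin (λ i → l (suc i) * (a ·ᵥ K (suc i)))
      az : l zero * Y + S ≡ 0ℚ
      az = trans (sym (·ᵥ-combination a l K)) (trans (sym (sumFin-cong (λ j → cong (a j *_) (z≗ j)))) az≡0)
      l₀ : l zero ≡ - (S * inv Y)
      l₀ = trans (y≡x*z⇒x≡y*inv[z] aK₀≢0 (sym (trans (solve 2 (λ p s → p := (p :+ s) :- s) refl (l zero * Y) S)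
                                                    (trans (cong (_- S) az) (QP.+-identityˡ (- S))))))
                 (sym (QP.neg-distribˡ-* S (inv Y)))
      z≡ : ∀ j → z j ≡ sumFin (λ i → l (suc i) * reduce a K i j)
      z≡ j = begin
          z j
            ≡⟨ z≗ j ⟩
          l zero * K zero j + T
            ≡⟨ cong (λ w → w * K zero j + T) l₀ ⟩
          - (S * inv Y) * K zero j + T
            ≡⟨ solve 3 (λ t s k → (:- s) :* k :+ t := t :- s :* k) refl T (S * inv Y) (K zero j) ⟩
          T - (S * inv Y) * K zero j
            ≡⟨ cong (λ w → T - w * K zero j) (trans (*-distribʳ-sumFin (inv Y) (λ i → l (suc i) * (a ·ᵥ K (suc i))))
                                                     (sumFin-cong (λ i → QP.*-assoc (l (suc i)) _ (inv Y)))) ⟩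
          T - sumFin (λ i → l (suc i) * μ i) * K zero j
            ≡⟨ cong (λ w → T - w) (*-distribʳ-sumFin (K zero j) (λ i → l (suc i) * μ i)) ⟩
          T - sumFin (λ i → (l (suc i) * μ i) * K zero j)
            ≡⟨ sym (sumFin-- (λ i → l (suc i) * K (suc i) j) (λ i → (l (suc i) * μ i) * K zero j)) ⟩
          sumFin (λ i → l (suc i) * K (suc i) j - (l (suc i) * μ i) * K zero j)
            ≡⟨ sumFin-cong (λ i → solve 4 (λ l k m z → l :* k :- (l :* m) :* z := l :* (k :- m :* z)) refl (l (suc i)) (K (suc i) j) (μ i) (K zero j)) ⟩
          sumFin (λ i → l (suc i) * reduce a K i j) ∎
        where
        open ≡-Reasoning
        T = sumFin (λ i → l (suc i) * K (suc i) j)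

module BoundedIntegers where

  open import Data.Nat as ℕ using (ℕ; zero; suc; _!; _^_; z≤n)
  open import Data.Nat.Properties as NP using ()
  open import Data.Nat.Divisibility using (_∣_; divides)
  open import Data.Nat.Coprimality as Coprime using ()
  open import Data.Nat.Solver using (module +-*-Solver)
  open import Data.Integer as ℤ using (ℤ; +_)
  open import Data.Integer.Properties as ZP using ()
  open import Data.Integer.Solver as ZS using ()
  open import Data.Rational as ℚ using (ℚ; 0ℚ; 1ℚ; _+_; _*_; _-_; -_; mkℚ)
  open import Data.Rational.Properties as QP using ()
  open import Data.Rational.Unnormalised.Properties as QUP using ()
  open import Data.Rational.Unnormalised using (*≡*)
  open import Data.Fin using (Fin; zero; suc)
  open import Data.Bool using (true; false)
  open import Data.Vec.Functional using (tail)
  open import Data.List using (List; []; _∷_; _++_; map; [_]; length)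
  open import Data.List.Properties using (++-assoc; length-++; length-map)
  open import Data.List.Relation.Unary.All as All using (All; []; _∷_)
  open import Data.List.Relation.Unary.All.Properties as All using ()
  open import Data.Product using (Σ; _,_; _×_; proj₁; proj₂)
  open import Relation.Binary.PropositionalEquality hiding ([_])
  open import Defs using (Vector; sumFin; bit)
  open FinSums using (δ)
  open Determinant

  fromℤ : ℤ → ℚ
  fromℤ z = mkℚ z 0 (Coprime.sym (Coprime.1-coprimeTo _))

  private
    module Z = ZS.+-*-Solver

  fromℤ-+ : ∀ a b → fromℤ (a ℤ.+ b) ≡ fromℤ a + fromℤ b
  fromℤ-+ a b = QP.toℚᵘ-injective (QUP.≃-sym (QUP.≃-trans (QP.toℚᵘ-homo-+ (fromℤ a) (fromℤ b))
    (*≡* (Z.solve 2 (λ a b → (a Z.:* Z.con (+ 1) Z.:+ b Z.:* Z.con (+ 1)) Z.:* Z.con (+ 1) Z.:= (a Z.:+ b) Z.:* Z.con (+ 1)) refl a b))))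

  fromℤ-* : ∀ a b → fromℤ (a ℤ.* b) ≡ fromℤ a * fromℤ b
  fromℤ-* a b = QP.toℚᵘ-injective (QUP.≃-sym (QUP.≃-trans (QP.toℚᵘ-homo-* (fromℤ a) (fromℤ b)) (*≡* refl)))

  fromℤ-neg : ∀ a → fromℤ (ℤ.- a) ≡ - fromℤ a
  fromℤ-neg a = QP.toℚᵘ-injective (QUP.≃-sym (QP.toℚᵘ-homo‿- (fromℤ a)))

  fromℤ-- : ∀ a b → fromℤ (a ℤ.- b) ≡ fromℤ a - fromℤ b
  fromℤ-- a b = trans (fromℤ-+ a (ℤ.- b)) (cong (λ z → fromℤ a + z) (fromℤ-neg b))

  BoundedInt : ℕ → ℚ → Set
  BoundedInt H q = Σ ℤ λ z → (q ≡ fromℤ z) × (ℤ.∣ z ∣ ℕ.≤ H)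

  BoundedInt-mono : ∀ {a b q} → a ℕ.≤ b → BoundedInt a q → BoundedInt b q
  BoundedInt-mono a≤b (z , q≡z , ∣z∣≤a) = z , q≡z , NP.≤-trans ∣z∣≤a a≤b

  BoundedInt-0 : ∀ {a} → BoundedInt a 0ℚ
  BoundedInt-0 = + 0 , refl , z≤n

  BoundedInt-1 : BoundedInt 1 1ℚ
  BoundedInt-1 = + 1 , refl , NP.≤-refl

  BoundedInt-neg : ∀ {a x} → BoundedInt a x → BoundedInt a (- x)
  BoundedInt-neg (z , x≡z , h) = ℤ.- z , trans (cong -_ x≡z) (sym (fromℤ-neg z)) , subst (ℕ._≤ _) (sym (ZP.∣-i∣≡∣i∣ z)) h

  BoundedInt-+ : ∀ {a b x y} → BoundedInt a x → BoundedInt b y → BoundedInt (a ℕ.+ b) (x + y)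
  BoundedInt-+ (z₁ , e₁ , h₁) (z₂ , e₂ , h₂) = z₁ ℤ.+ z₂ , trans (cong₂ _+_ e₁ e₂) (sym (fromℤ-+ z₁ z₂)) ,
    NP.≤-trans (ZP.∣i+j∣≤∣i∣+∣j∣ z₁ z₂) (NP.+-mono-≤ h₁ h₂)

  BoundedInt-- : ∀ {a b x y} → BoundedInt a x → BoundedInt b y → BoundedInt (a ℕ.+ b) (x - y)
  BoundedInt-- (z₁ , e₁ , h₁) (z₂ , e₂ , h₂) = z₁ ℤ.- z₂ , trans (cong₂ _-_ e₁ e₂) (sym (fromℤ-- z₁ z₂)) ,
    NP.≤-trans (ZP.∣i-j∣≤∣i∣+∣j∣ z₁ z₂) (NP.+-mono-≤ h₁ h₂)

  BoundedInt-* : ∀ {a b x y} → BoundedInt a x → BoundedInt b y → BoundedInt (a ℕ.* b) (x * y)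
  BoundedInt-* (z₁ , e₁ , h₁) (z₂ , e₂ , h₂) = z₁ ℤ.* z₂ , trans (cong₂ _*_ e₁ e₂) (sym (fromℤ-* z₁ z₂)) ,
    subst (ℕ._≤ _) (sym (ZP.abs-* z₁ z₂)) (NP.*-mono-≤ h₁ h₂)

  BoundedInt-sumFin : ∀ {k} (f : Fin k → ℚ) b → (∀ i → BoundedInt b (f i)) → BoundedInt (k ℕ.* b) (sumFin f)
  BoundedInt-sumFin {zero}  f b h = BoundedInt-0
  BoundedInt-sumFin {suc k} f b h = BoundedInt-+ (h zero) (BoundedInt-sumFin (λ i → f (suc i)) b (λ i → h (suc i)))

  BoundedInt-δ : ∀ {k} (i j : Fin k) → BoundedInt 1 (δ i j)
  BoundedInt-δ zero    zero    = BoundedInt-1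
  BoundedInt-δ zero    (suc j) = BoundedInt-0
  BoundedInt-δ (suc i) zero    = BoundedInt-0
  BoundedInt-δ (suc i) (suc j) = BoundedInt-δ i j

  BoundedInt-bit : ∀ b → BoundedInt 1 (bit b)
  BoundedInt-bit true  = BoundedInt-1
  BoundedInt-bit false = BoundedInt-0

  *-denominator : ∀ (q : ℚ) → q * fromℤ (+ ℚ.denominatorℕ q) ≡ fromℤ (ℚ.numerator q)
  *-denominator q@(mkℚ n d-1 _) = QP.toℚᵘ-injective (QUP.≃-trans (QP.toℚᵘ-homo-* q (fromℤ (+ suc d-1)))
    (*≡* (Z.solve 2 (λ n d → (n Z.:* d) Z.:* Z.con (+ 1) Z.:= n Z.:* (d Z.:* Z.con (+ 1))) refl n (+ suc d-1))))

  denominator∣⇒BoundedInt : ∀ (q : ℚ) L → ℚ.denominatorℕ q ∣ L → BoundedInt (ℤ.∣ ℚ.numerator q ∣ ℕ.* L) (fromℤ (+ L) * q)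
  denominator∣⇒BoundedInt q L (divides c refl) = + c ℤ.* ℚ.numerator q , eq , bound
    where
    D = ℚ.denominatorℕ q
    eq : fromℤ (+ (c ℕ.* D)) * q ≡ fromℤ (+ c ℤ.* ℚ.numerator q)
    eq = begin
        fromℤ (+ (c ℕ.* D)) * q             ≡⟨ cong (λ z → fromℤ z * q) (ZP.pos-* c D) ⟩
        fromℤ (+ c ℤ.* + D) * q             ≡⟨ cong (_* q) (fromℤ-* (+ c) (+ D)) ⟩
        (fromℤ (+ c) * fromℤ (+ D)) * q     ≡⟨ QP.*-assoc (fromℤ (+ c)) (fromℤ (+ D)) q ⟩
        fromℤ (+ c) * (fromℤ (+ D) * q)     ≡⟨ cong (fromℤ (+ c) *_) (trans (QP.*-comm _ q) (*-denominator q)) ⟩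
        fromℤ (+ c) * fromℤ (ℚ.numerator q) ≡⟨ sym (fromℤ-* (+ c) (ℚ.numerator q)) ⟩
        fromℤ (+ c ℤ.* ℚ.numerator q)       ∎
      where open ≡-Reasoning
    bound : ℤ.∣ + c ℤ.* ℚ.numerator q ∣ ℕ.≤ ℤ.∣ ℚ.numerator q ∣ ℕ.* (c ℕ.* D)
    bound = NP.≤-trans (NP.≤-reflexive (trans (ZP.abs-* (+ c) (ℚ.numerator q)) (NP.*-comm c _)))
                       (NP.*-monoʳ-≤ ℤ.∣ ℚ.numerator q ∣ (NP.m≤m*n c D))

  BoundedRow : ∀ {d} → ℕ → Vector d → Set
  BoundedRow H r = ∀ k → BoundedInt H (r k)

  private
    All-remove : ∀ {A : Set} {P : A → Set} (as : List A) r rs → All P (as ++ r ∷ rs) → All P (as ++ rs) × P r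
    All-remove []       r rs (pr ∷ ps) = ps , pr
    All-remove (a ∷ as) r rs (pa ∷ ps) = let ps′ , pr = All-remove as r rs ps in pa ∷ ps′ , pr

    length-remove : ∀ {A : Set} (as : List A) r rs {n} → length (as ++ r ∷ rs) ≡ suc n → length (as ++ rs) ≡ n
    length-remove as r rs len = NP.suc-injective (begin
        suc (length (as ++ rs))       ≡⟨ cong suc (length-++ as) ⟩
        suc (length as ℕ.+ length rs) ≡⟨ sym (NP.+-suc (length as) (length rs)) ⟩
        length as ℕ.+ length (r ∷ rs) ≡⟨ sym (length-++ as) ⟩
        length (as ++ r ∷ rs)         ≡⟨ len ⟩
        _                             ∎)
      where open ≡-Reasoning

  mutual
    det-BoundedInt : ∀ {d} H (rs : List (Vector d)) → length rs ≡ d → All (BoundedRow H) rs →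
                     BoundedInt (d ! ℕ.* H ^ d) (det rs)
    det-BoundedInt {zero}  H [] len hs = BoundedInt-1
    det-BoundedInt {suc d} H rs len hs = BoundedInt-mono (NP.≤-reflexive count) (laplace-BoundedInt H [] rs len hs)
      where
      open +-*-Solver
      count : length rs ℕ.* (H ℕ.* (d ! ℕ.* H ^ d)) ≡ suc d ! ℕ.* H ^ suc d
      count rewrite len = solve 4 (λ n h f p → (con 1 :+ n) :* (h :* (f :* p)) := ((con 1 :+ n) :* f) :* (h :* p)) refl d H (d !) (H ^ d)

    laplace-BoundedInt : ∀ {d} H (as rs : List (Vector (suc d))) → length (as ++ rs) ≡ suc d → All (BoundedRow H) (as ++ rs) →
                         BoundedInt (length rs ℕ.* (H ℕ.* (d ! ℕ.* H ^ d))) (laplace as rs)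
    laplace-BoundedInt H as [] len hs = BoundedInt-0
    laplace-BoundedInt {d} H as (r ∷ rs) len hs =
      BoundedInt-- (BoundedInt-* (hr zero) (det-BoundedInt H (map tail (as ++ rs))
                                             (trans (length-map tail (as ++ rs)) (length-remove as r rs len))
                                             (All.map⁺ (All.map (λ h k → h (suc k)) hrest))))
                   (laplace-BoundedInt H (as ++ [ r ]) rs (subst (λ z → length z ≡ suc d) (sym (++-assoc as [ r ] rs)) len)
                                       (subst (All (BoundedRow H)) (sym (++-assoc as [ r ] rs)) hs))
      where
      hrest : All (BoundedRow H) (as ++ rs)
      hrest = proj₁ (All-remove as r rs hs)
      hr : BoundedRow H r
      hr = proj₂ (All-remove as r rs hs)

module BitLength where

  open import Data.Nat as ℕ using (ℕ; zero; suc; _+_; _*_; _^_; _≤_; _<_; z≤n; s≤s; ⌈_/2⌉)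
  open import Data.Nat.Properties as NP using ()
  open import Data.Nat.Logarithm using (⌈log₂_⌉; ⌈log₂⌉-mono-≤; ⌈log₂2^n⌉≡n)
  open import Data.Nat.Logarithm.Core using (⌈log2⌉)
  open import Data.Nat.Induction using (<-wellFounded)
  open import Data.Nat.Divisibility as Div using (_∣_; divides)
  open import Data.Nat.Coprimality as Coprime using ()
  open import Data.Nat.Solver using (module +-*-Solver)
  open import Data.Integer as ℤ using (ℤ; +_)
  open import Data.Integer.Properties as ZP using ()
  open import Data.Rational as ℚ using (ℚ; mkℚ)
  open import Data.Rational.Properties as QP using ()
  open import Data.Rational.Unnormalised.Properties as QUP using ()
  open import Data.Rational.Unnormalised using (*≡*)
  open import Data.Fin using (Fin; zero; suc)
  open import Induction.WellFounded using (Acc; acc)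
  open import Relation.Binary.PropositionalEquality
  import Relation.Nullary.Decidable as Dec
  open import Defs
  open BoundedIntegers using (fromℤ)
  open +-*-Solver

  private
    ≤-2^⌈log2⌉ : ∀ n (rec : Acc _<_ n) → n ≤ 2 ^ ⌈log2⌉ n rec
    ≤-2^⌈log2⌉ zero                _          = z≤n
    ≤-2^⌈log2⌉ (suc zero)          _          = s≤s z≤n
    ≤-2^⌈log2⌉ (suc (suc k)) (acc rs) = NP.≤-trans halve (NP.*-monoʳ-≤ 2 (≤-2^⌈log2⌉ (suc ⌈ k /2⌉) _))
      where
      halve : suc (suc k) ≤ 2 * suc ⌈ k /2⌉
      halve = NP.≤-trans (s≤s (s≤s (NP.≤-trans (NP.≤-reflexive (sym (NP.⌊n/2⌋+⌈n/2⌉≡n k)))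
                                               (NP.+-monoˡ-≤ ⌈ k /2⌉ (NP.⌊n/2⌋≤⌈n/2⌉ k)))))
                         (NP.≤-reflexive (solve 1 (λ c → con 2 :+ (c :+ c) := con 2 :* (con 1 :+ c)) refl ⌈ k /2⌉))

  <2^bitsℕ : ∀ k → k < 2 ^ bitsℕ k
  <2^bitsℕ k = NP.≤-trans (≤-2^⌈log2⌉ (suc k) (<-wellFounded (suc k))) (NP.^-monoʳ-≤ 2 (NP.n≤1+n ⌈log₂ suc k ⌉))

  bitsℕ-mono : ∀ {k k′} → k ≤ k′ → bitsℕ k ≤ bitsℕ k′
  bitsℕ-mono k≤k′ = s≤s (⌈log₂⌉-mono-≤ (s≤s k≤k′))

  1≤2^ : ∀ e → 1 ≤ 2 ^ e
  1≤2^ e = NP.m^n>0 2 e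

  bitsℕ-≤ : ∀ {k e} → k ≤ 2 ^ e → bitsℕ k ≤ 2 + e
  bitsℕ-≤ {k} {e} k≤2^e = s≤s (NP.≤-trans (⌈log₂⌉-mono-≤ 1+k≤2^[1+e]) (NP.≤-reflexive (⌈log₂2^n⌉≡n (suc e))))
    where
    1+k≤2^[1+e] : suc k ≤ 2 ^ suc e
    1+k≤2^[1+e] = NP.≤-trans (NP.+-mono-≤ (1≤2^ e) k≤2^e) (NP.≤-reflexive (cong (λ z → 2 ^ e + z) (sym (NP.+-identityʳ _))))

  ∣numerator∣≤2^bitsℚ : ∀ q → ℤ.∣ ℚ.numerator q ∣ ≤ 2 ^ bitsℚ q
  ∣numerator∣≤2^bitsℚ q = NP.≤-trans (NP.<⇒≤ (<2^bitsℕ a)) (NP.^-monoʳ-≤ 2 (NP.≤-trans (NP.m≤m+n (bitsℕ a) (bitsℕ b)) (NP.n≤1+n _)))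
    where a = ℤ.∣ ℚ.numerator q ∣; b = ℚ.denominatorℕ q

  denominator≤2^bitsℚ : ∀ q → ℚ.denominatorℕ q ≤ 2 ^ bitsℚ q
  denominator≤2^bitsℚ q = NP.≤-trans (NP.<⇒≤ (<2^bitsℕ b)) (NP.^-monoʳ-≤ 2 (NP.≤-trans (NP.m≤n+m (bitsℕ b) (bitsℕ a)) (NP.n≤1+n _)))
    where a = ℤ.∣ ℚ.numerator q ∣; b = ℚ.denominatorℕ q

  -- q is in lowest terms, so its numerator and denominator are bounded by ∣P∣ and ∣Q∣.
  bitsℚ-fraction : ∀ (q : ℚ) P Q → Q ≢ + 0 → q ℚ.* fromℤ Q ≡ fromℤ P → bitsℚ q ≤ suc (bitsℕ ℤ.∣ P ∣ + bitsℕ ℤ.∣ Q ∣)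
  bitsℚ-fraction q@(mkℚ n d-1 coprime) P Q Q≢0 qQ≡P =
    s≤s (NP.+-mono-≤ (bitsℕ-mono ∣n∣≤∣P∣) (bitsℕ-mono d≤∣Q∣))
    where
    cross : ℤ.∣ n ∣ * ℤ.∣ Q ∣ ≡ ℤ.∣ P ∣ * suc d-1
    cross with QUP.≃-trans (QUP.≃-sym (QP.toℚᵘ-homo-* q (fromℤ Q))) (QUP.≃-reflexive (cong ℚ.toℚᵘ qQ≡P))
    ... | *≡* eq = trans (sym (ZP.abs-* n Q))
                   (trans (cong ℤ.∣_∣ (trans (sym (ZP.*-identityʳ (n ℤ.* Q))) (trans eq (cong (P ℤ.*_) (cong +_ (NP.*-identityʳ (suc d-1)))))))
                          (ZP.abs-* P (+ suc d-1)))
    instance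
      ∣Q∣≢0 : ℕ.NonZero ℤ.∣ Q ∣
      ∣Q∣≢0 = ℕ.≢-nonZero (λ ∣Q∣≡0 → Q≢0 (ZP.∣i∣≡0⇒i≡0 ∣Q∣≡0))
    d≤∣Q∣ : suc d-1 ≤ ℤ.∣ Q ∣
    d≤∣Q∣ = Div.∣⇒≤ (Coprime.coprime-divisor (Coprime.sym (Dec.recompute (Coprime.coprime? ℤ.∣ n ∣ (suc d-1)) coprime))
                                            (divides ℤ.∣ P ∣ cross))
    ∣n∣≤∣P∣ : ℤ.∣ n ∣ ≤ ℤ.∣ P ∣
    ∣n∣≤∣P∣ = NP.*-cancelʳ-≤ ℤ.∣ n ∣ ℤ.∣ P ∣ ℤ.∣ Q ∣ (NP.≤-trans (NP.≤-reflexive cross) (NP.*-monoʳ-≤ ℤ.∣ P ∣ d≤∣Q∣))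

  sumFinℕ-≥ : ∀ {k} (f : Fin k → ℕ) i → f i ≤ sumFinℕ f
  sumFinℕ-≥ f zero    = NP.m≤m+n _ _
  sumFinℕ-≥ f (suc i) = NP.≤-trans (sumFinℕ-≥ (λ i → f (suc i)) i) (NP.m≤n+m _ (f zero))

  sumFinℕ-≤ : ∀ {k} (f : Fin k → ℕ) b → (∀ i → f i ≤ b) → sumFinℕ f ≤ k * b
  sumFinℕ-≤ {zero}  f b f≤b = z≤n
  sumFinℕ-≤ {suc k} f b f≤b = NP.+-mono-≤ (f≤b zero) (sumFinℕ-≤ (λ i → f (suc i)) b (λ i → f≤b (suc i)))

  bitsℚ-entry≤bitsMat : ∀ {m n} (A : Matrix m n) i j → bitsℚ (A i j) ≤ bitsMat A
  bitsℚ-entry≤bitsMat A i j =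
    NP.≤-trans (sumFinℕ-≥ (λ j → bitsℚ (A i j)) j) (sumFinℕ-≥ (λ i → sumFinℕ (λ j → bitsℚ (A i j))) i)

  prodFinℕ : ∀ {k} → (Fin k → ℕ) → ℕ
  prodFinℕ {zero}  f = 1
  prodFinℕ {suc k} f = f zero * prodFinℕ (λ i → f (suc i))

  ∣prodFinℕ : ∀ {k} (f : Fin k → ℕ) i → f i ∣ prodFinℕ f
  ∣prodFinℕ f zero    = Div.∣m⇒∣m*n _ Div.∣-refl
  ∣prodFinℕ f (suc i) = Div.∣n⇒∣m*n (f zero) (∣prodFinℕ (λ i → f (suc i)) i)

  prodFinℕ-pos : ∀ {k} (f : Fin k → ℕ) → (∀ i → 0 < f i) → 0 < prodFinℕ f
  prodFinℕ-pos {zero}  f f>0 = s≤s z≤n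
  prodFinℕ-pos {suc k} f f>0 = NP.*-mono-< (f>0 zero) (prodFinℕ-pos (λ i → f (suc i)) (λ i → f>0 (suc i)))

  prodFinℕ≤2^sumFinℕ : ∀ {k} (f g : Fin k → ℕ) → (∀ i → f i ≤ 2 ^ g i) → prodFinℕ f ≤ 2 ^ sumFinℕ g
  prodFinℕ≤2^sumFinℕ {zero}  f g h = s≤s z≤n
  prodFinℕ≤2^sumFinℕ {suc k} f g h =
    NP.≤-trans (NP.*-mono-≤ (h zero) (prodFinℕ≤2^sumFinℕ (λ i → f (suc i)) (λ i → g (suc i)) (λ i → h (suc i))))
               (NP.≤-reflexive (sym (NP.^-distribˡ-+-* 2 (g zero) _)))

module PolynomialBound where

  open import Data.Nat using (ℕ; zero; suc; _+_; _*_; _^_; _≤_; z≤n; s≤s; _!)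
  open import Data.Nat.Properties
  open import Data.Nat.Solver using (module +-*-Solver)
  open import Relation.Binary.PropositionalEquality
  open import Defs using (bitsℕ)
  open BitLength using (1≤2^; bitsℕ-≤)
  open +-*-Solver
  open ≤-Reasoning

  suc≤2^ : ∀ k → suc k ≤ 2 ^ k
  suc≤2^ zero    = s≤s z≤n
  suc≤2^ (suc k) = +-mono-≤ (1≤2^ k) (≤-trans (suc≤2^ k) (≤-reflexive (sym (+-identityʳ _))))

  !≤2^[k*k] : ∀ k → k ! ≤ 2 ^ (k * k)
  !≤2^[k*k] zero    = s≤s z≤n
  !≤2^[k*k] (suc k) = begin
      suc k * k !                 ≤⟨ *-mono-≤ (suc≤2^ k) (!≤2^[k*k] k) ⟩
      2 ^ k * 2 ^ (k * k)         ≡⟨ sym (^-distribˡ-+-* 2 k (k * k)) ⟩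
      2 ^ (k + k * k)             ≤⟨ ^-monoʳ-≤ 2 (m≤n+m (k + k * k) (suc k)) ⟩
      2 ^ (suc k + (k + k * k))   ≡⟨ cong (2 ^_) (solve 1 (λ k → (con 1 :+ k) :+ (k :+ k :* k) := (con 1 :+ k) :* (con 1 :+ k)) refl k) ⟩
      2 ^ (suc k * suc k)         ∎

  -- Bound on the absolute values of the (integer) entries of the lifted constraint system of
  -- a matrix with n columns and bit complexity B.
  entryBound : ℕ → ℕ → ℕ
  entryBound n B = suc n * (2 ^ B * 2 ^ B)

  -- Bound on the determinants of its (n+1) × (n+1) subsystems.
  detBound : ℕ → ℕ → ℕ
  detBound n B = suc n ! * entryBound n B ^ suc n

  coordinateBits : ℕ → ℕ → ℕ
  coordinateBits n B = suc (bitsℕ (detBound n B) + bitsℕ (detBound n B))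

  module _ (n B : ℕ) where
    private
      N = n + B + 1

    entryBound≤ : entryBound n B ≤ 2 ^ (n + (B + B))
    entryBound≤ = begin
      suc n * (2 ^ B * 2 ^ B)   ≤⟨ *-monoˡ-≤ _ (suc≤2^ n) ⟩
      2 ^ n * (2 ^ B * 2 ^ B)   ≡⟨ cong (2 ^ n *_) (sym (^-distribˡ-+-* 2 B B)) ⟩
      2 ^ n * 2 ^ (B + B)       ≡⟨ sym (^-distribˡ-+-* 2 n (B + B)) ⟩
      2 ^ (n + (B + B))         ∎

    detBound≤ : detBound n B ≤ 2 ^ (2 * (N * N))
    detBound≤ = begin
      suc n ! * entryBound n B ^ suc n
        ≤⟨ *-mono-≤ (!≤2^[k*k] (suc n)) (^-monoˡ-≤ (suc n) entryBound≤) ⟩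
      2 ^ (suc n * suc n) * (2 ^ (n + (B + B))) ^ suc n
        ≡⟨ cong (2 ^ (suc n * suc n) *_) (^-*-assoc 2 (n + (B + B)) (suc n)) ⟩
      2 ^ (suc n * suc n) * 2 ^ ((n + (B + B)) * suc n)
        ≡⟨ sym (^-distribˡ-+-* 2 (suc n * suc n) _) ⟩
      2 ^ (suc n * suc n + (n + (B + B)) * suc n)
        ≡⟨ cong (2 ^_) (solve 2 (λ n B → (con 1 :+ n) :* (con 1 :+ n) :+ (n :+ (B :+ B)) :* (con 1 :+ n)
                                      := (con 1 :+ n) :* (con 2 :* n :+ con 2 :* B :+ con 1)) refl n B) ⟩
      2 ^ (suc n * (2 * n + 2 * B + 1))
        ≤⟨ ^-monoʳ-≤ 2 (*-mono-≤ (≤-reflexive (+-comm 1 n)) (m≤m+n (2 * n + 2 * B + 1) 1)) ⟩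
      2 ^ ((n + 1) * (2 * n + 2 * B + 1 + 1))
        ≤⟨ ^-monoʳ-≤ 2 (*-mono-≤ (+-monoˡ-≤ 1 (m≤m+n n B)) (≤-reflexive (solve 2 (λ n B → con 2 :* n :+ con 2 :* B :+ con 1 :+ con 1 := con 2 :* (n :+ B :+ con 1)) refl n B))) ⟩
      2 ^ (N * (2 * N))
        ≡⟨ cong (2 ^_) (solve 1 (λ N → N :* (con 2 :* N) := con 2 :* (N :* N)) refl N) ⟩
      2 ^ (2 * (N * N)) ∎

    1≤N*N : 1 ≤ N * N
    1≤N*N = *-mono-≤ (m≤n+m 1 (n + B)) (m≤n+m 1 (n + B))

    coordinateBits≤ : coordinateBits n B ≤ 9 * (N * N)
    coordinateBits≤ = begin
      suc (bitsℕ (detBound n B) + bitsℕ (detBound n B))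
        ≤⟨ s≤s (+-mono-≤ (bitsℕ-≤ detBound≤) (bitsℕ-≤ detBound≤)) ⟩
      suc ((2 + 2 * (N * N)) + (2 + 2 * (N * N)))
        ≡⟨ solve 1 (λ X → con 1 :+ ((con 2 :+ con 2 :* X) :+ (con 2 :+ con 2 :* X)) := con 4 :* X :+ con 5) refl (N * N) ⟩
      4 * (N * N) + 5
        ≤⟨ +-monoʳ-≤ (4 * (N * N)) (*-monoʳ-≤ 5 1≤N*N) ⟩
      4 * (N * N) + 5 * (N * N)
        ≡⟨ solve 1 (λ X → con 4 :* X :+ con 5 :* X := con 9 :* X) refl (N * N) ⟩
      9 * (N * N) ∎

    4≤9N² : 4 ≤ 9 * (N * N)
    4≤9N² = ≤-trans (m≤m+n 4 5) (*-monoʳ-≤ 9 1≤N*N)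

    9N²≤9N³ : 9 * (N * N) ≤ 9 * N ^ 3
    9N²≤9N³ = begin
      9 * (N * N)         ≤⟨ *-monoʳ-≤ 9 (≤-trans (≤-reflexive (sym (*-identityʳ (N * N)))) (*-monoʳ-≤ (N * N) (m≤n+m 1 (n + B)))) ⟩
      9 * (N * N * N)     ≡⟨ cong (9 *_) (solve 1 (λ N → N :* N :* N := N :* (N :* (N :* con 1))) refl N) ⟩
      9 * N ^ 3           ∎

    n*9N²≤9N³ : n * (9 * (N * N)) ≤ 9 * N ^ 3
    n*9N²≤9N³ = begin
      n * (9 * (N * N))        ≤⟨ *-monoˡ-≤ (9 * (N * N)) (≤-trans (m≤m+n n B) (m≤m+n (n + B) 1)) ⟩
      N * (9 * (N * N))        ≡⟨ solve 1 (λ N → N :* (con 9 :* (N :* N)) := con 9 :* (N :* (N :* (N :* con 1)))) refl N ⟩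
      9 * N ^ 3                ∎

module ListFacts where

  open import Data.Nat as ℕ using (ℕ; zero; suc)
  open import Data.List using (List; []; _∷_; map; concatMap; length)
  open import Data.List.Relation.Unary.All using (All; []; _∷_)
  open import Data.List.Relation.Unary.Any as Any using (here; there)
  open import Data.List.Membership.Propositional using (_∈_; mapWith∈; find)
  open import Data.List.Membership.Propositional.Properties using (∈-map⁺; ∈-map⁻; ∈-concatMap⁺; ∈-concatMap⁻)
  open import Data.Product using (Σ; _,_)
  open import Relation.Binary.PropositionalEquality

  ∈-mapWith∈⁺ : ∀ {A B : Set} {xs : List A} (f : ∀ {x} → x ∈ xs → B) {x} (x∈ : x ∈ xs) → f x∈ ∈ mapWith∈ xs f
  ∈-mapWith∈⁺ f (here refl) = here refl
  ∈-mapWith∈⁺ f (there x∈)  = there (∈-mapWith∈⁺ (λ x∈ → f (there x∈)) x∈)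

  ∈-mapWith∈⁻ : ∀ {A B : Set} {xs : List A} (f : ∀ {x} → x ∈ xs → B) {b} → b ∈ mapWith∈ xs f →
                Σ A λ x → Σ (x ∈ xs) λ x∈ → b ≡ f x∈
  ∈-mapWith∈⁻ {xs = x ∷ xs} f (here refl) = x , here refl , refl
  ∈-mapWith∈⁻ {xs = x ∷ xs} f (there b∈) with ∈-mapWith∈⁻ (λ x∈ → f (there x∈)) b∈
  ... | y , y∈ , eq = y , there y∈ , eq

  tuples : ∀ {A : Set} → ℕ → List A → List (List A)
  tuples zero    xs = [] ∷ []
  tuples (suc k) xs = concatMap (λ x → map (x ∷_) (tuples k xs)) xs

  ∈-tuples : ∀ {A : Set} k (xs ys : List A) → length ys ≡ k → All (_∈ xs) ys → ys ∈ tuples k xs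
  ∈-tuples zero    xs []       refl []          = here refl
  ∈-tuples (suc k) xs (y ∷ ys) len  (y∈ ∷ ys⊆) =
    ∈-concatMap⁺ (λ x → map (x ∷_) (tuples k xs))
      (Any.map (λ { refl → ∈-map⁺ (y ∷_) (∈-tuples k xs ys (cong ℕ.pred len) ys⊆) }) y∈)

  length-∈-tuples : ∀ {A : Set} k (xs : List A) {ys} → ys ∈ tuples k xs → length ys ≡ k
  length-∈-tuples zero    xs (here refl) = refl
  length-∈-tuples (suc k) xs ys∈ with find (∈-concatMap⁻ (λ x → map (x ∷_) (tuples k xs)) {xs = xs} ys∈)
  ... | x , _ , ys∈′ with ∈-map⁻ (x ∷_) ys∈′
  ...   | zs , zs∈ , refl = cong suc (length-∈-tuples k xs zs∈)

module LindiscFacts where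

  open import Data.Nat using (ℕ; zero; suc)
  open import Data.Rational as ℚ using (ℚ; 0ℚ; 1ℚ; _*_; _-_; -_; _≤_; _<_; _⊓_; _⊔_; ∣_∣)
  open import Data.Rational.Properties as QP using ()
  open import Data.Rational.Solver using (module +-*-Solver)
  open import Data.Fin using (Fin; zero; suc)
  open import Data.Bool using (Bool; true; false)
  open import Data.List using (List; []; _∷_; map; foldr)
  open import Data.List.Relation.Unary.All using (All; []; _∷_)
  open import Data.List.Relation.Unary.Any using (here; there)
  open import Data.List.Membership.Propositional using (_∈_)
  open import Data.List.Membership.Propositional.Properties using (∈-map⁺)
  open import Data.Product using (Σ; _,_)
  open import Data.Sum using (inj₁; inj₂)
  open import Relation.Binary.PropositionalEquality
  open import Data.Empty using (⊥-elim)
  open import Defs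
  open RationalFacts
  open FinSums
  open +-*-Solver

  maxFin-nonNeg : ∀ {k} (g : Fin k → ℚ) → 0ℚ ≤ maxFin g
  maxFin-nonNeg {zero}  g = QP.≤-refl
  maxFin-nonNeg {suc k} g = QP.≤-trans (maxFin-nonNeg (λ i → g (suc i))) (QP.p≤q⊔p (g zero) _)

  ≤-maxFin : ∀ {k} (g : Fin k → ℚ) i → g i ≤ maxFin g
  ≤-maxFin g zero    = QP.p≤p⊔q (g zero) _
  ≤-maxFin g (suc i) = QP.≤-trans (≤-maxFin (λ i → g (suc i)) i) (QP.p≤q⊔p (g zero) _)

  maxFin-attains : ∀ {k} (g : Fin k → ℚ) {t} → 0ℚ < t → t ≤ maxFin g → Σ (Fin k) λ i → t ≤ g i
  maxFin-attains {zero}  g 0<t t≤0 = ⊥-elim (QP.<-irrefl refl (QP.<-≤-trans 0<t t≤0))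
  maxFin-attains {suc k} g {t} 0<t t≤max with QP.≤-total (g zero) (maxFin (λ i → g (suc i)))
  ... | inj₁ g₀≤rest with maxFin-attains (λ i → g (suc i)) 0<t (subst (t ≤_) (QP.p≤q⇒p⊔q≡q g₀≤rest) t≤max)
  ...   | i , t≤gᵢ = suc i , t≤gᵢ
  maxFin-attains {suc k} g {t} 0<t t≤max | inj₂ rest≤g₀ = zero , subst (t ≤_) (QP.p≥q⇒p⊔q≡p rest≤g₀) t≤max

  maxFin-cong : ∀ {k} {f g : Fin k → ℚ} → (∀ i → f i ≡ g i) → maxFin f ≡ maxFin g
  maxFin-cong {zero}  f≗g = refl
  maxFin-cong {suc k} f≗g = cong₂ _⊔_ (f≗g zero) (maxFin-cong (λ i → f≗g (suc i)))

  foldr-⊓-≤-seed : ∀ s qs → foldr _⊓_ s qs ≤ s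
  foldr-⊓-≤-seed s []       = QP.≤-refl
  foldr-⊓-≤-seed s (q ∷ qs) = QP.≤-trans (QP.p⊓q≤q q _) (foldr-⊓-≤-seed s qs)

  foldr-⊓-≤-∈ : ∀ s {q} qs → q ∈ qs → foldr _⊓_ s qs ≤ q
  foldr-⊓-≤-∈ s (q ∷ qs) (here refl) = QP.p⊓q≤p q _
  foldr-⊓-≤-∈ s (q ∷ qs) (there q∈) = QP.≤-trans (QP.p⊓q≤q q _) (foldr-⊓-≤-∈ s qs q∈)

  foldr-⊓-glb : ∀ {t} s qs → t ≤ s → All (t ≤_) qs → t ≤ foldr _⊓_ s qs
  foldr-⊓-glb s []       t≤s []           = t≤s
  foldr-⊓-glb s (q ∷ qs) t≤s (t≤q ∷ t≤qs) = QP.⊓-glb t≤q (foldr-⊓-glb s qs t≤s t≤qs)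

  polarity : Bool → ℚ
  polarity true  = 1ℚ
  polarity false = - 1ℚ

  p≤∣p∣ : ∀ p → p ≤ ∣ p ∣
  p≤∣p∣ p with QP.∣p∣≡p∨∣p∣≡-p p
  ... | inj₁ ∣p∣≡p  = QP.≤-reflexive (sym ∣p∣≡p)
  ... | inj₂ ∣p∣≡-p = QP.≤-trans (subst (_≤ 0ℚ) (neg-involutive p) (QP.neg-antimono-≤ (subst (0ℚ ≤_) ∣p∣≡-p (QP.0≤∣p∣ p))))
                                 (QP.0≤∣p∣ p)

  polarity-≤∣∣ : ∀ {t} s q → t ≤ polarity s * q → t ≤ ∣ q ∣
  polarity-≤∣∣ true  q t≤q  = QP.≤-trans (subst (_ ≤_) (QP.*-identityˡ q) t≤q) (p≤∣p∣ q)
  polarity-≤∣∣ false q t≤-q = QP.≤-trans (subst (_ ≤_) (solve 1 (λ q → (:- con 1ℚ) :* q := :- q) refl q) t≤-q)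
                                        (subst (- q ≤_) (QP.∣-p∣≡∣p∣ q) (p≤∣p∣ (- q)))

  ∣∣-polarity : ∀ {t} q → t ≤ ∣ q ∣ → Σ Bool λ s → t ≤ polarity s * q
  ∣∣-polarity {t} q t≤∣q∣ with QP.∣p∣≡p∨∣p∣≡-p q
  ... | inj₁ ∣q∣≡q  = true  , subst (t ≤_) (trans ∣q∣≡q (sym (QP.*-identityˡ q))) t≤∣q∣
  ... | inj₂ ∣q∣≡-q = false , subst (t ≤_) (trans ∣q∣≡-q (solve 1 (λ q → :- q := (:- con 1ℚ) :* q) refl q)) t≤∣q∣

  module _ {m n : ℕ} (A : Matrix m n) where

    distance : Vector n → (Fin n → Bool) → ℚ
    distance w x = ‖ A · (λ j → w j - toVec x j) ‖∞

    lindiscAt-cong : ∀ {w w′} → (∀ j → w j ≡ w′ j) → lindiscAt A w ≡ lindiscAt A w′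
    lindiscAt-cong {w} {w′} w≗w′ = go zeroBits (allBinary n)
      where
      distance-cong : ∀ x → distance w x ≡ distance w′ x
      distance-cong x = maxFin-cong (λ i → cong ∣_∣ (sumFin-cong (λ j → cong (λ z → A i j * (z - toVec x j)) (w≗w′ j))))
      go : ∀ s xs → foldr _⊓_ (distance w s) (map (distance w) xs) ≡ foldr _⊓_ (distance w′ s) (map (distance w′) xs)
      go s []       = distance-cong s
      go s (x ∷ xs) = cong₂ _⊓_ (distance-cong x) (go s xs)

    lindiscAt≤distance : ∀ w {x} → x ∈ zeroBits ∷ allBinary n → lindiscAt A w ≤ distance w x
    lindiscAt≤distance w (here refl) = foldr-⊓-≤-seed _ (map (distance w) (allBinary n))
    lindiscAt≤distance w (there x∈)  = foldr-⊓-≤-∈ _ (map (distance w) (allBinary n)) (∈-map⁺ (distance w) x∈)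

    ≤-lindiscAt : ∀ w {t} → (∀ {x} → x ∈ zeroBits ∷ allBinary n → t ≤ distance w x) → t ≤ lindiscAt A w
    ≤-lindiscAt w t≤ = foldr-⊓-glb _ (map (distance w) (allBinary n)) (t≤ (here refl)) (all (allBinary n) (λ x∈ → t≤ (there x∈)))
      where
      all : ∀ xs → (∀ {x} → x ∈ xs → _ ≤ distance w x) → All (_ ≤_) (map (distance w) xs)
      all []       h = []
      all (x ∷ xs) h = h (here refl) ∷ all xs (λ x∈ → h (there x∈))

    lindiscAt-nonNeg : ∀ w → 0ℚ ≤ lindiscAt A w
    lindiscAt-nonNeg w = ≤-lindiscAt w (λ {x} _ → maxFin-nonNeg (λ i → ∣ (A · (λ j → w j - toVec x j)) i ∣))

module PushToVertex where

  open import Data.Nat as ℕ using (ℕ; zero; suc)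
  open import Data.Nat.Properties as NP using ()
  open import Data.Rational as ℚ using (ℚ; 0ℚ; 1ℚ; _+_; _*_; _-_; -_; _≤_; _<_)
  open import Data.Rational.Properties as QP using ()
  open import Data.Rational.Solver using (module +-*-Solver)
  open import Data.Fin using (Fin; zero; suc)
  open import Data.List using (List; []; _∷_; map; length; filter)
  open import Data.List.Relation.Unary.All as All using (All; []; _∷_)
  open import Data.List.Relation.Unary.All.Properties as All using ()
  open import Data.List.Membership.Propositional using (_∈_)
  open import Data.List.Membership.Propositional.Properties using (∈-filter⁺; ∈-filter⁻)
  open import Data.Product using (Σ; _,_; _×_; proj₁; proj₂)
  open import Relation.Binary.Bundles using (DecTotalOrder)
  open import Relation.Binary.PropositionalEquality
  open import Relation.Nullary using (yes; no)
  open import Relation.Unary using (Decidable)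
  open import Defs using (Vector)
  open RationalFacts
  open FinSums
  open DeterminantKernel using (Nonzero; TrivialKernel)
  open KernelBasis
  import Data.List.Extrema
  open +-*-Solver

  private
    open module Extrema = Data.List.Extrema (DecTotalOrder.totalOrder QP.≤-decTotalOrder)
      using (argmin; argmin-all; f[argmin]≤f[xs])

  -- The polyhedron { y | β c ≤ a c ·ᵥ y for c ∈ cs } in ℚ^(1+d), in which we maximise y₀.
  module _ {D : Set} {d : ℕ} (a : D → Vector (suc d)) (β : D → ℚ) (cs : List D) where

    Feasible : Vector (suc d) → Set
    Feasible y = ∀ {c} → c ∈ cs → β c ≤ a c ·ᵥ y

    AscentBlocked : Set
    AscentBlocked = ∀ v → Nonzero v → 0ℚ ≤ v zero → Σ D λ c → c ∈ cs × a c ·ᵥ v < 0ℚ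

    record VertexAbove (y : Vector (suc d)) : Set where
      field
        vertex      : Vector (suc d)
        feasible    : Feasible vertex
        above       : y zero ≤ vertex zero
        tight       : List D
        tight-size  : length tight ≡ suc d
        tight⊆cs    : All (_∈ cs) tight
        tight-eq    : All (λ c → a c ·ᵥ vertex ≡ β c) tight
        determines  : TrivialKernel (map a tight)

    -- The ratio test for moving from y along v: blocking constraint c becomes tight at y + ratio c · v.
    module RatioTest (y v : Vector (suc d)) where

      Blocking : D → Set
      Blocking c = a c ·ᵥ v < 0ℚ

      ratio : D → ℚ
      ratio c = (a c ·ᵥ y - β c) * inv (- (a c ·ᵥ v))

      move : ℚ → Vector (suc d)
      move t j = y j + t * v j

      ratio-nonNeg : ∀ {c} → β c ≤ a c ·ᵥ y → Blocking c → 0ℚ ≤ ratio c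
      ratio-nonNeg fc bc = *-nonNeg (p≤q⇒0≤q-p fc) (QP.<⇒≤ (inv-pos (QP.neg-antimono-< bc)))

      ratio-* : ∀ {c} → Blocking c → ratio c * (- (a c ·ᵥ v)) ≡ a c ·ᵥ y - β c
      ratio-* {c} bc = trans (QP.*-assoc (a c ·ᵥ y - β c) (inv (- (a c ·ᵥ v))) (- (a c ·ᵥ v)))
        (trans (cong ((a c ·ᵥ y - β c) *_) (inv-inverseˡ _ (pos⇒≢0 (QP.neg-antimono-< bc)))) (QP.*-identityʳ _))

      gap-move : ∀ c t → a c ·ᵥ move t - β c ≡ (a c ·ᵥ y - β c) + t * (a c ·ᵥ v)
      gap-move c t = trans (cong (_- β c) (·ᵥ-linear (a c) y v t))
        (solve 4 (λ A t V b → (A :+ t :* V) :- b := (A :- b) :+ t :* V) refl (a c ·ᵥ y) t (a c ·ᵥ v) (β c))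

      move-feasible-nonBlocking : ∀ {c} t → 0ℚ ≤ t → β c ≤ a c ·ᵥ y → 0ℚ ≤ a c ·ᵥ v → β c ≤ a c ·ᵥ move t
      move-feasible-nonBlocking {c} t 0≤t fc 0≤av =
        ≤-via-difference _ (gap-move c t) (+-nonNeg (p≤q⇒0≤q-p fc) (*-nonNeg 0≤t 0≤av))

      move-feasible-blocking : ∀ {c} t → Blocking c → t ≤ ratio c → β c ≤ a c ·ᵥ move t
      move-feasible-blocking {c} t bc t≤ratio = ≤-via-difference ((ratio c - t) * (- (a c ·ᵥ v)))
        (trans (gap-move c t) (trans (cong (_+ t * (a c ·ᵥ v)) (sym (ratio-* bc)))
          (solve 3 (λ r t V → r :* (:- V) :+ t :* V := (r :- t) :* (:- V)) refl (ratio c) t (a c ·ᵥ v))))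
        (*-nonNeg (p≤q⇒0≤q-p t≤ratio) (QP.<⇒≤ (QP.neg-antimono-< bc)))

      move-tight : ∀ {c} → Blocking c → a c ·ᵥ move (ratio c) ≡ β c
      move-tight {c} bc = begin
          a c ·ᵥ move (ratio c)                       ≡⟨ ·ᵥ-linear (a c) y v (ratio c) ⟩
          a c ·ᵥ y + ratio c * (a c ·ᵥ v)             ≡⟨ solve 3 (λ A r V → A :+ r :* V := A :- r :* (:- V)) refl (a c ·ᵥ y) (ratio c) (a c ·ᵥ v) ⟩
          a c ·ᵥ y - ratio c * (- (a c ·ᵥ v))         ≡⟨ cong (λ z → a c ·ᵥ y - z) (ratio-* bc) ⟩
          a c ·ᵥ y - (a c ·ᵥ y - β c)                 ≡⟨ solve 2 (λ A b → A :- (A :- b) := b) refl (a c ·ᵥ y) (β c) ⟩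
          β c                                         ∎
        where open ≡-Reasoning

      move-keeps-tight : ∀ {c} t → a c ·ᵥ y ≡ β c → a c ·ᵥ v ≡ 0ℚ → a c ·ᵥ move t ≡ β c
      move-keeps-tight {c} t ay≡β av≡0 = trans (·ᵥ-linear (a c) y v t)
        (trans (cong₂ (λ u w → u + t * w) ay≡β av≡0) (solve 2 (λ b t → b :+ t :* con 0ℚ := b) refl (β c) t))

      blocking? : Decidable Blocking
      blocking? c = a c ·ᵥ v QP.<? 0ℚ

      firstBlocking : D → D
      firstBlocking c₀ = argmin ratio c₀ (filter blocking? cs)

      module _ {c₀} (c₀∈cs : c₀ ∈ cs) (c₀-blocks : Blocking c₀) where

        firstBlocking-blocks : firstBlocking c₀ ∈ cs × Blocking (firstBlocking c₀)
        firstBlocking-blocks = argmin-all ratio (c₀∈cs , c₀-blocks) (All.tabulate (∈-filter⁻ blocking?))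

        firstBlocking-least : ∀ {c} → c ∈ cs → Blocking c → ratio (firstBlocking c₀) ≤ ratio c
        firstBlocking-least c∈cs bc = All.lookup (f[argmin]≤f[xs] c₀ (filter blocking? cs)) (∈-filter⁺ blocking? c∈cs bc)

        move-feasible : Feasible y → Feasible (move (ratio (firstBlocking c₀)))
        move-feasible fy {c} c∈cs with blocking? c
        ... | yes bc = move-feasible-blocking _ bc (firstBlocking-least c∈cs bc)
        ... | no ¬bc = move-feasible-nonBlocking _
                         (ratio-nonNeg (fy (proj₁ firstBlocking-blocks)) (proj₂ firstBlocking-blocks))
                         (fy c∈cs) (QP.≮⇒≥ ¬bc)

    -- The state of the pushing procedure: the tight constraints S found so far, and a basis K
    -- (with pivot coordinates) of the directions keeping all of them tight.
    record Frame (k : ℕ) (y : Vector (suc d)) : Set where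
      field
        S       : List D
        size    : length S ℕ.+ k ≡ suc d
        S⊆cs    : All (_∈ cs) S
        S-tight : All (λ c → a c ·ᵥ y ≡ β c) S
        K       : Fin k → Vector (suc d)
        piv     : Fin k → Fin (suc d)
        pivots  : HasPivots K piv
        K⊥S     : All (λ c → ∀ i → a c ·ᵥ K i ≡ 0ℚ) S
        spans   : Spans (map a S) K

    initialFrame : ∀ y → Frame (suc d) y
    initialFrame y = record
      { S = [] ; size = refl ; S⊆cs = [] ; S-tight = []
      ; K = λ i j → δ i j ; piv = λ j → j ; pivots = λ i j → refl ; K⊥S = []
      ; spans = λ z _ → z , (λ j → sym (sumFin-δ z j)) }

    -- One pushing step: move along ±K 0 until the first constraint c* becomes tight; reducing K
    -- along a c* keeps a basis of the directions that keep S and c* tight.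
    module Step {k y} (blocked : AscentBlocked) (fy : Feasible y) (fr : Frame (suc k) y) where
      open Frame fr

      σ : ℚ
      σ = orientation (K zero zero)

      v : Vector (suc d)
      v j = σ * K zero j

      open RatioTest y v

      v⊥ : ∀ c → a c ·ᵥ K zero ≡ 0ℚ → a c ·ᵥ v ≡ 0ℚ
      v⊥ c aK₀≡0 = trans (·ᵥ-scale (a c) (K zero) σ) (trans (cong (σ *_) aK₀≡0) (QP.*-zeroʳ σ))

      v≢0 : Nonzero v
      v≢0 = piv zero , λ vₚ≡0 → orientation≢0 (K zero zero)
                         (trans (sym (trans (cong (σ *_) (pivots zero zero)) (QP.*-identityʳ σ))) vₚ≡0)

      blocker : Σ D λ c → c ∈ cs × Blocking c
      blocker = blocked v v≢0 (orientation-nonNeg (K zero zero))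

      c* : D
      c* = firstBlocking (proj₁ blocker)

      c*∈cs×blocks : c* ∈ cs × Blocking c*
      c*∈cs×blocks = firstBlocking-blocks (proj₁ (proj₂ blocker)) (proj₂ (proj₂ blocker))

      c*K₀≢0 : a c* ·ᵥ K zero ≢ 0ℚ
      c*K₀≢0 aK₀≡0 = QP.<-irrefl (v⊥ c* aK₀≡0) (proj₂ c*∈cs×blocks)

      y′ : Vector (suc d)
      y′ = move (ratio c*)

      y′-feasible : Feasible y′
      y′-feasible = move-feasible (proj₁ (proj₂ blocker)) (proj₂ (proj₂ blocker)) fy

      y′-above : y zero ≤ y′ zero
      y′-above = ≤-via-difference (ratio c* * v zero)
        (solve 2 (λ y x → (y :+ x) :- y := x) refl (y zero) (ratio c* * v zero))
        (*-nonNeg (ratio-nonNeg (fy (proj₁ c*∈cs×blocks)) (proj₂ c*∈cs×blocks)) (orientation-nonNeg (K zero zero)))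

      c*-tight : a c* ·ᵥ y′ ≡ β c*
      c*-tight = move-tight (proj₂ c*∈cs×blocks)

      S-stays-tight : ∀ {T} → All (λ c → a c ·ᵥ y ≡ β c) T → All (λ c → ∀ i → a c ·ᵥ K i ≡ 0ℚ) T →
                      All (λ c → a c ·ᵥ y′ ≡ β c) T
      S-stays-tight []               []           = []
      S-stays-tight (c-tight ∷ tight) (K⊥c ∷ K⊥) =
        move-keeps-tight (ratio c*) c-tight (v⊥ _ (K⊥c zero)) ∷ S-stays-tight tight K⊥

      frame′ : Frame k y′
      frame′ = record
        { S = c* ∷ S
        ; size = trans (sym (NP.+-suc (length S) k)) size
        ; S⊆cs = proj₁ c*∈cs×blocks ∷ S⊆cs
        ; S-tight = c*-tight ∷ S-stays-tight S-tight K⊥S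
        ; K = reduce (a c*) K
        ; piv = λ j → piv (suc j)
        ; pivots = reduce-pivots (a c*) K pivots
        ; K⊥S = reduce-orthogonal (a c*) K c*K₀≢0 ∷ All.map (λ {c} → reduce-kernel (a c*) K (a c)) K⊥S
        ; spans = reduce-spans (a c*) K c*K₀≢0 spans }

    push : ∀ {k y} → AscentBlocked → Feasible y → Frame k y → VertexAbove y
    push {zero} {y} blocked fy fr = record
      { vertex = y ; feasible = fy ; above = QP.≤-refl
      ; tight = S ; tight-size = trans (sym (NP.+-identityʳ (length S))) size ; tight⊆cs = S⊆cs ; tight-eq = S-tight
      ; determines = λ z ker j → proj₂ (spans z ker) j }
      where open Frame fr
    push {suc k} {y} blocked fy fr = record
      { vertex = vertex ; feasible = feasible ; above = QP.≤-trans y′-above above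
      ; tight = tight ; tight-size = tight-size ; tight⊆cs = tight⊆cs ; tight-eq = tight-eq ; determines = determines }
      where
      open Step blocked fy fr using (y′; y′-feasible; y′-above; frame′)
      open VertexAbove (push blocked y′-feasible frame′)

    vertexAbove : AscentBlocked → ∀ y → Feasible y → VertexAbove y
    vertexAbove blocked y fy = push blocked fy (initialFrame y)

module LiftedSystem {m n : ℕ} (A : Matrix m n) where

  open import Data.Nat as ℕ using (zero; suc)
  open import Data.Integer as ℤ using (+_)
  open import Data.Rational as ℚ using (ℚ; 0ℚ; 1ℚ; _+_; _*_; _-_; -_; _≤_; _<_)
  open import Data.Rational.Properties as QP using ()
  open import Data.Rational.Solver using (module +-*-Solver)
  open import Data.Fin using (Fin; zero; suc)
  open import Data.Bool using (Bool; true; false)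
  open import Data.Vec.Functional using (tail)
  open import Data.List using (List; _∷_; _++_; map; allFin; concatMap)
  open import Data.List.Relation.Unary.Any as Any using ()
  open import Data.List.Membership.Propositional using (_∈_)
  open import Data.List.Membership.Propositional.Properties
    using (∈-++⁺ˡ; ∈-++⁺ʳ; ∈-++⁻; ∈-map⁺; ∈-map⁻; ∈-allFin; ∈-concatMap⁺)
  open import Data.Product using (Σ; _,_; _×_; proj₁; proj₂)
  open import Data.Sum using (inj₁; inj₂)
  open import Data.Empty using (⊥-elim)
  open import Relation.Binary.Definitions using (tri<; tri≈; tri>)
  open import Relation.Binary.PropositionalEquality
  open import Defs
  open RationalFacts
  open FinSums
  open BoundedIntegers using (fromℤ)
  open BitLength using (prodFinℕ; prodFinℕ-pos)
  open LindiscFacts using (polarity)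
  open +-*-Solver

  -- lindiscAt A w ≥ t > 0 holds iff for every x ∈ {0,1}ⁿ some row i and sign s satisfy
  -- t ≤ s (A (w - x))ᵢ; each of these is a linear inequality in (t, w) ∈ ℚ^(1+n).
  data Constraint : Set where
    lower : Fin n → Constraint
    upper : Fin n → Constraint
    row   : Fin m → Bool → (Fin n → Bool) → Constraint

  denominators : ℕ
  denominators = prodFinℕ (λ i → prodFinℕ (λ j → ℚ.denominatorℕ (A i j)))

  -- Row constraints are scaled by the product of all denominators of A, so that every
  -- constraint has integer coefficients.
  scale : ℚ
  scale = fromℤ (+ denominators)

  0<scale : 0ℚ < scale
  0<scale with denominators | prodFinℕ-pos (λ i → prodFinℕ (λ j → ℚ.denominatorℕ (A i j)))
                                           (λ i → prodFinℕ-pos (λ j → ℚ.denominatorℕ (A i j)) (λ j → ℕ.s≤s ℕ.z≤n))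
  ... | suc _ | _ = ℚ.*<* (ℤ.+<+ (ℕ.s≤s ℕ.z≤n))

  coefficients : Constraint → Vector (suc n)
  coefficients (lower j)   zero    = 0ℚ
  coefficients (lower j)   (suc k) = δ k j
  coefficients (upper j)   zero    = 0ℚ
  coefficients (upper j)   (suc k) = - δ k j
  coefficients (row i s x) zero    = - scale
  coefficients (row i s x) (suc k) = scale * (polarity s * A i k)

  bound : Constraint → ℚ
  bound (lower j)   = 0ℚ
  bound (upper j)   = - 1ℚ
  bound (row i s x) = scale * (polarity s * (A i ·ᵥ toVec x))

  Satisfies : Vector (suc n) → Constraint → Set
  Satisfies y c = bound c ≤ coefficients c ·ᵥ y

  residual : Fin m → Vector (suc n) → (Fin n → Bool) → ℚ
  residual i y x = (A · (λ j → tail y j - toVec x j)) i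

  lower-·ᵥ : ∀ j (y : Vector (suc n)) → coefficients (lower j) ·ᵥ y ≡ y (suc j)
  lower-·ᵥ j y = trans (cong₂ _+_ (QP.*-zeroˡ (y zero)) (sumFin-cong (λ k → QP.*-comm (δ k j) (y (suc k)))))
                       (trans (QP.+-identityˡ _) (sumFin-δ (tail y) j))

  upper-·ᵥ : ∀ j (y : Vector (suc n)) → coefficients (upper j) ·ᵥ y ≡ - y (suc j)
  upper-·ᵥ j y = trans (cong₂ _+_ (QP.*-zeroˡ (y zero))
                                  (sumFin-cong (λ k → solve 2 (λ d w → (:- d) :* w := :- (w :* d)) refl (δ k j) (y (suc k)))))
                       (trans (QP.+-identityˡ _) (trans (sumFin-neg (λ k → y (suc k) * δ k j)) (cong -_ (sumFin-δ (tail y) j))))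

  row-·ᵥ : ∀ i s x (y : Vector (suc n)) → coefficients (row i s x) ·ᵥ y ≡ scale * (polarity s * (A i ·ᵥ tail y) - y zero)
  row-·ᵥ i s x y = begin
      - scale * y zero + sumFin (λ k → (scale * (polarity s * A i k)) * y (suc k))
        ≡⟨ cong (λ z → - scale * y zero + z) (trans (sumFin-cong (λ k → solve 4 (λ L s a y → (L :* (s :* a)) :* y := L :* (s :* (a :* y))) refl scale (polarity s) (A i k) (y (suc k))))
             (trans (sym (*-distribˡ-sumFin scale (λ k → polarity s * (A i k * y (suc k)))))
                    (cong (scale *_) (sym (*-distribˡ-sumFin (polarity s) (λ k → A i k * y (suc k))))))) ⟩
      - scale * y zero + scale * (polarity s * (A i ·ᵥ tail y))
        ≡⟨ solve 3 (λ L t S → (:- L) :* t :+ L :* S := L :* (S :- t)) refl scale (y zero) (polarity s * (A i ·ᵥ tail y)) ⟩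
      scale * (polarity s * (A i ·ᵥ tail y) - y zero) ∎
    where open ≡-Reasoning

  row-slack : ∀ i s x (y : Vector (suc n)) →
              coefficients (row i s x) ·ᵥ y - bound (row i s x) ≡ scale * (polarity s * residual i y x - y zero)
  row-slack i s x y = begin
      coefficients (row i s x) ·ᵥ y - bound (row i s x)
        ≡⟨ cong (_- bound (row i s x)) (row-·ᵥ i s x y) ⟩
      scale * (polarity s * (A i ·ᵥ tail y) - y zero) - scale * (polarity s * (A i ·ᵥ toVec x))
        ≡⟨ solve 5 (λ L g a t b → L :* (g :* a :- t) :- L :* (g :* b) := L :* (g :* (a :- b) :- t)) refl
                   scale (polarity s) (A i ·ᵥ tail y) (y zero) (A i ·ᵥ toVec x) ⟩
      scale * (polarity s * (A i ·ᵥ tail y - A i ·ᵥ toVec x) - y zero)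
        ≡⟨ cong (λ z → scale * (polarity s * z - y zero)) (sym residual-split) ⟩
      scale * (polarity s * residual i y x - y zero) ∎
    where
    open ≡-Reasoning
    residual-split : residual i y x ≡ A i ·ᵥ tail y - A i ·ᵥ toVec x
    residual-split = trans (sumFin-cong (λ j → solve 3 (λ a w x → a :* (w :- x) := a :* w :- a :* x) refl (A i j) (y (suc j)) (toVec x j)))
                           (sumFin-- (λ j → A i j * y (suc j)) (λ j → A i j * toVec x j))

  row-satisfied⇒ : ∀ i s x y → Satisfies y (row i s x) → y zero ≤ polarity s * residual i y x
  row-satisfied⇒ i s x y sat = 0≤q-p⇒p≤q (QP.*-cancelˡ-≤-pos scale {{ℚ.positive 0<scale}}
    (subst₂ _≤_ (sym (QP.*-zeroʳ scale)) (row-slack i s x y) (p≤q⇒0≤q-p sat)))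

  row-satisfied⇐ : ∀ i s x y → y zero ≤ polarity s * residual i y x → Satisfies y (row i s x)
  row-satisfied⇐ i s x y t≤r = 0≤q-p⇒p≤q (subst (0ℚ ≤_) (sym (row-slack i s x y)) (*-nonNeg (QP.<⇒≤ 0<scale) (p≤q⇒0≤q-p t≤r)))

  lower-satisfied⇒ : ∀ j y → Satisfies y (lower j) → 0ℚ ≤ y (suc j)
  lower-satisfied⇒ j y = subst (0ℚ ≤_) (lower-·ᵥ j y)

  lower-satisfied⇐ : ∀ j y → 0ℚ ≤ y (suc j) → Satisfies y (lower j)
  lower-satisfied⇐ j y = subst (0ℚ ≤_) (sym (lower-·ᵥ j y))

  upper-satisfied⇒ : ∀ j y → Satisfies y (upper j) → y (suc j) ≤ 1ℚ
  upper-satisfied⇒ j y sat = ≤-via-difference (- y (suc j) - - 1ℚ) (solve 1 (λ w → con 1ℚ :- w := (:- w) :- (:- con 1ℚ)) refl (y (suc j)))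
    (subst (λ z → 0ℚ ≤ z - - 1ℚ) (upper-·ᵥ j y) (p≤q⇒0≤q-p sat))

  upper-satisfied⇐ : ∀ j y → y (suc j) ≤ 1ℚ → Satisfies y (upper j)
  upper-satisfied⇐ j y w≤1 = subst (- 1ℚ ≤_) (sym (upper-·ᵥ j y)) (QP.neg-antimono-≤ w≤1)

  boxConstraints : List Constraint
  boxConstraints = map lower (allFin n) ++ map upper (allFin n)

  allConstraints : List Constraint
  allConstraints = boxConstraints ++ concatMap (λ i → map (row i true) (zeroBits ∷ allBinary n) ++ map (row i false) (zeroBits ∷ allBinary n)) (allFin m)

  lower∈box : ∀ j → lower j ∈ boxConstraints
  lower∈box j = ∈-++⁺ˡ (∈-map⁺ lower (∈-allFin j))

  upper∈box : ∀ j → upper j ∈ boxConstraints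
  upper∈box j = ∈-++⁺ʳ (map lower (allFin n)) (∈-map⁺ upper (∈-allFin j))

  row∈all : ∀ i s {x} → x ∈ zeroBits ∷ allBinary n → row i s x ∈ allConstraints
  row∈all i s {x} x∈ = ∈-++⁺ʳ boxConstraints (∈-concatMap⁺ _ (Any.map (λ { refl → row∈ s }) (∈-allFin i)))
    where
    row∈ : ∀ s → row i s x ∈ map (row i true) (zeroBits ∷ allBinary n) ++ map (row i false) (zeroBits ∷ allBinary n)
    row∈ true  = ∈-++⁺ˡ (∈-map⁺ (row i true) x∈)
    row∈ false = ∈-++⁺ʳ (map (row i true) (zeroBits ∷ allBinary n)) (∈-map⁺ (row i false) x∈)

  cube⇒box : ∀ y → InUnitCube (tail y) → ∀ {c} → c ∈ boxConstraints → Satisfies y c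
  cube⇒box y cube c∈ with ∈-++⁻ (map lower (allFin n)) c∈
  ... | inj₁ c∈lower with ∈-map⁻ lower c∈lower
  ...   | j , _ , refl = lower-satisfied⇐ j y (proj₁ (cube j))
  cube⇒box y cube c∈ | inj₂ c∈upper with ∈-map⁻ upper c∈upper
  ...   | j , _ , refl = upper-satisfied⇐ j y (proj₂ (cube j))

  box⇒cube : ∀ y → (∀ {c} → c ∈ boxConstraints → Satisfies y c) → InUnitCube (tail y)
  box⇒cube y sat j = lower-satisfied⇒ j y (sat (lower∈box j)) , upper-satisfied⇒ j y (sat (upper∈box j))

  box-blocks : ∀ (v : Vector (suc n)) j → v (suc j) ≢ 0ℚ → Σ Constraint λ c → c ∈ boxConstraints × coefficients c ·ᵥ v < 0ℚ
  box-blocks v j vⱼ≢0 with QP.<-cmp (v (suc j)) 0ℚ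
  ... | tri< vⱼ<0 _ _ = lower j , lower∈box j , subst (_< 0ℚ) (sym (lower-·ᵥ j v)) vⱼ<0
  ... | tri≈ _ vⱼ≡0 _ = ⊥-elim (vⱼ≢0 vⱼ≡0)
  ... | tri> _ _ vⱼ>0 = upper j , upper∈box j , subst (_< 0ℚ) (sym (upper-·ᵥ j v)) (QP.neg-antimono-< vⱼ>0)

  row-blocks : ∀ i s x (v : Vector (suc n)) → (∀ j → v (suc j) ≡ 0ℚ) → 0ℚ < v zero → coefficients (row i s x) ·ᵥ v < 0ℚ
  row-blocks i s x v tail≡0 0<v₀ = subst (_< 0ℚ) (sym (trans (row-·ᵥ i s x v) (cong (λ z → scale * (polarity s * z - v zero)) Aᵢv≡0)))
    (subst (_< 0ℚ) (solve 3 (λ L g x → :- (L :* x) := L :* (g :* con 0ℚ :- x)) refl scale (polarity s) (v zero))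
           (QP.neg-antimono-< (*-pos 0<scale 0<v₀)))
    where
    Aᵢv≡0 : A i ·ᵥ tail v ≡ 0ℚ
    Aᵢv≡0 = sumFin-zero _ (λ k → trans (cong (A i k *_) (tail≡0 k)) (QP.*-zeroʳ (A i k)))

module Vertices {m n : ℕ} (A : Matrix m n) where

  open import Data.Nat using (zero; suc)
  open import Data.Rational as ℚ using (ℚ; 0ℚ; _*_; _≤_; _<_; ∣_∣)
  open import Data.Rational.Properties as QP using ()
  open import Data.Rational.Solver using (module +-*-Solver)
  open import Data.Fin using (Fin; zero; suc)
  open import Data.Bool using (Bool)
  open import Data.Vec.Functional as VF using (tail)
  open import Data.List using (List; _∷_; _++_; map; length)
  open import Data.List.Relation.Unary.All as All using (All)
  open import Data.List.Relation.Unary.Any using (here)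
  open import Data.List.Membership.Propositional using (_∈_; mapWith∈)
  open import Data.List.Membership.Propositional.Properties using (∈-++⁺ˡ; ∈-++⁺ʳ; ∈-++⁻)
  open import Data.Product using (Σ; _,_; proj₁; proj₂)
  open import Data.Sum using (inj₁; inj₂)
  open import Relation.Binary.PropositionalEquality
  open import Relation.Binary.Definitions using (tri<; tri≈; tri>)
  open import Data.Empty using (⊥; ⊥-elim)
  open import Defs
  open RationalFacts
  open FinSums
  open DeterminantKernel using (Nonzero; nonzero?; TrivialKernel)
  open LindiscFacts
  open ListFacts
  open PushToVertex
  open LiftedSystem A
  open +-*-Solver

  record LiftedVertex (t : ℚ) : Set where
    field
      y          : Vector (suc n)
      cube       : InUnitCube (tail y)
      t≤y₀       : t ≤ y zero
      y₀≤lindisc : y zero ≤ lindiscAt A (tail y)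
      S          : List Constraint
      S-size     : length S ≡ suc n
      S⊆         : All (_∈ allConstraints) S
      S-tight    : All (λ c → coefficients c ·ᵥ y ≡ bound c) S
      determines : TrivialKernel (map coefficients S)

  module _ (w : Vector n) (cube : InUnitCube w) {t} (0<t : 0ℚ < t) (t≤lindisc : t ≤ lindiscAt A w) where

    private
      y₀ : Vector (suc n)
      y₀ = t VF.∷ w

      RowChoice : (Fin n → Bool) → Set
      RowChoice x = Σ (Fin m) λ i → Σ Bool λ s → t ≤ polarity s * residual i y₀ x

      choose : ∀ {x} → x ∈ zeroBits ∷ allBinary n → RowChoice x
      choose {x} x∈ = i , ∣∣-polarity (residual i y₀ x) t≤∣r∣
        where
        attained : Σ (Fin m) λ i → t ≤ ∣ residual i y₀ x ∣
        attained = maxFin-attains (λ i → ∣ residual i y₀ x ∣) 0<t (QP.≤-trans t≤lindisc (lindiscAt≤distance A w x∈))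
        i = proj₁ attained
        t≤∣r∣ = proj₂ attained

      chosenRow : ∀ {x} → x ∈ zeroBits ∷ allBinary n → Constraint
      chosenRow {x} x∈ = row (proj₁ (choose x∈)) (proj₁ (proj₂ (choose x∈))) x

      cs : List Constraint
      cs = boxConstraints ++ mapWith∈ (zeroBits ∷ allBinary n) chosenRow

      feasible₀ : Feasible coefficients bound cs y₀
      feasible₀ c∈ with ∈-++⁻ boxConstraints c∈
      ... | inj₁ c∈box = cube⇒box y₀ cube c∈box
      ... | inj₂ c∈rows with ∈-mapWith∈⁻ chosenRow c∈rows
      ...   | x , x∈ , refl = row-satisfied⇐ (proj₁ (choose x∈)) (proj₁ (proj₂ (choose x∈))) x y₀ (proj₂ (proj₂ (choose x∈)))

      -- A direction moving w is stopped by the cube; one fixing w and raising t is stopped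
      -- by any row constraint.
      blocked : AscentBlocked coefficients bound cs
      blocked v v≢0 0≤v₀ with nonzero? (tail v)
      ... | inj₁ (j , vⱼ≢0) = let c , c∈box , c·v<0 = box-blocks v j vⱼ≢0 in c , ∈-++⁺ˡ c∈box , c·v<0
      ... | inj₂ tail≡0 = chosenRow here₀ , ∈-++⁺ʳ boxConstraints (∈-mapWith∈⁺ chosenRow here₀) ,
                          row-blocks (proj₁ (choose here₀)) (proj₁ (proj₂ (choose here₀))) zeroBits v tail≡0 0<v₀
        where
        here₀ : zeroBits ∈ zeroBits ∷ allBinary n
        here₀ = here refl
        0<v₀ : 0ℚ < v zero
        0<v₀ with QP.<-cmp 0ℚ (v zero)
        ... | tri< 0<v₀ _ _ = 0<v₀
        ... | tri≈ _ 0≡v₀ _ = ⊥-elim (headZero v≢0)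
          where
          headZero : Nonzero v → ⊥
          headZero (zero , v₀≢0) = v₀≢0 (sym 0≡v₀)
          headZero (suc j , vⱼ≢0) = vⱼ≢0 (tail≡0 j)
        ... | tri> _ _ v₀<0 = ⊥-elim (QP.<-irrefl refl (QP.<-≤-trans v₀<0 0≤v₀))

      cs⊆all : ∀ {c} → c ∈ cs → c ∈ allConstraints
      cs⊆all c∈ with ∈-++⁻ boxConstraints c∈
      ... | inj₁ c∈box = ∈-++⁺ˡ c∈box
      ... | inj₂ c∈rows with ∈-mapWith∈⁻ chosenRow c∈rows
      ...   | x , x∈ , refl = row∈all (proj₁ (choose x∈)) (proj₁ (proj₂ (choose x∈))) x∈

      ≤-lindisc : ∀ y → Feasible coefficients bound cs y → y zero ≤ lindiscAt A (tail y)
      ≤-lindisc y fy = ≤-lindiscAt A (tail y) λ {x} x∈ →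
        let i = proj₁ (choose x∈) ; s = proj₁ (proj₂ (choose x∈)) in
        QP.≤-trans (polarity-≤∣∣ s (residual i y x)
                     (row-satisfied⇒ i s x y (fy (∈-++⁺ʳ boxConstraints (∈-mapWith∈⁺ chosenRow x∈)))))
                   (≤-maxFin (λ i → ∣ residual i y x ∣) i)

    liftedVertex : LiftedVertex t
    liftedVertex = record
      { y = vertex
      ; cube = box⇒cube vertex (λ c∈box → feasible (∈-++⁺ˡ c∈box))
      ; t≤y₀ = above
      ; y₀≤lindisc = ≤-lindisc vertex feasible
      ; S = tight
      ; S-size = tight-size
      ; S⊆ = All.map cs⊆all tight⊆cs
      ; S-tight = tight-eq
      ; determines = determines }
      where open VertexAbove (vertexAbove coefficients bound cs blocked y₀ feasible₀)

module Candidates {m n : ℕ} (A : Matrix m n) where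

  open import Data.Nat using (zero; suc)
  open import Data.Rational as ℚ using (ℚ; 0ℚ; 1ℚ; _*_; _≤_; _<_)
  open import Data.Rational.Properties as QP using ()
  open import Data.Fin using (Fin; zero; suc)
  open import Data.Fin.Properties using (all?)
  open import Data.Vec.Functional using (tail)
  open import Data.List using (List; []; _∷_; map; length; filter)
  open import Data.List.Properties using (length-map)
  open import Data.List.Relation.Unary.All as All using (All; []; _∷_)
  open import Data.List.Relation.Binary.Pointwise using ([]; _∷_)
  open import Data.List.Membership.Propositional using (_∈_)
  open import Data.List.Membership.Propositional.Properties using (∈-filter⁺; ∈-filter⁻; ∈-map⁺; ∈-map⁻)
  open import Data.Product using (Σ; _,_; _×_; proj₁; proj₂)
  open import Data.Sum using (_⊎_; inj₁; inj₂)
  open import Relation.Binary.Bundles using (DecTotalOrder)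
  open import Relation.Binary.PropositionalEquality
  open import Relation.Nullary using (Dec; yes; no)
  open import Relation.Nullary.Decidable using (_×-dec_)
  open import Defs
  open RationalFacts
  open FinSums
  open Determinant
  open CramersRule
  open DeterminantKernel using (TrivialKernel)
  open LindiscFacts
  open ListFacts
  import Data.List.Extrema
  open LiftedSystem A
  open Vertices A

  private
    open module Extrema = Data.List.Extrema (DecTotalOrder.totalOrder QP.≤-decTotalOrder)
      using (argmax; argmax-all; argmax-sel; f[xs]≤f[argmax]; f[⊥]≤f[argmax])

  numerator : List Constraint → Fin (suc n) → ℚ
  numerator S j = det (map (λ c → setAt j (bound c) (coefficients c)) S)

  -- The point where the constraints S are tight, by Cramer's rule (the zero vector when
  -- det = 0, since inv 0ℚ = 0ℚ).
  vertexOf : List Constraint → Vector (suc n)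
  vertexOf S j = numerator S j * inv (det (map coefficients S))

  vertexOf-unique : ∀ S y → length S ≡ suc n → TrivialKernel (map coefficients S) →
                    All (λ c → coefficients c ·ᵥ y ≡ bound c) S → ∀ j → y j ≡ vertexOf S j
  vertexOf-unique S y len trivial tight j =
    trans (cramer-solve (map coefficients S) (trans (length-map coefficients S) len) trivial y j)
          (cong (_* inv (det (map coefficients S))) (det-cong (rhs-eq S tight)))
    where
    rhs-eq : ∀ S → All (λ c → coefficients c ·ᵥ y ≡ bound c) S →
             RowsEq (map (λ r → setAt j (r ·ᵥ y) r) (map coefficients S)) (map (λ c → setAt j (bound c) (coefficients c)) S)
    rhs-eq []       []             = []
    rhs-eq (c ∷ S) (c-tight ∷ tight) = (λ k → cong (λ b → setAt j b (coefficients c) k) c-tight) ∷ rhs-eq S tight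

  inUnitCube? : ∀ {k} (w : Vector k) → Dec (InUnitCube w)
  inUnitCube? w = all? (λ j → (0ℚ QP.≤? w j) ×-dec (w j QP.≤? 1ℚ))

  vertexPoints : List (Vector n)
  vertexPoints = map (λ S → tail (vertexOf S)) (tuples (suc n) allConstraints)

  candidates : List (Vector n)
  candidates = filter inUnitCube? vertexPoints

  origin : Vector n
  origin _ = 0ℚ



  record Dominating (w : Vector n) : Set where
    field
      S          : List Constraint
      S∈         : S ∈ tuples (suc n) allConstraints
      lindisc≤   : lindiscAt A w ≤ vertexOf S zero
      ≤lindisc   : vertexOf S zero ≤ lindiscAt A (tail (vertexOf S))
      candidate  : tail (vertexOf S) ∈ candidates

  dominating : ∀ w → InUnitCube w → 0ℚ < lindiscAt A w → Dominating w
  dominating w cube 0<lindisc = record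
    { S = S
    ; S∈ = S∈
    ; lindisc≤ = subst (lindiscAt A w ≤_) (y≗ zero) t≤y₀
    ; ≤lindisc = subst₂ _≤_ (y≗ zero) (lindiscAt-cong A (λ j → y≗ (suc j))) y₀≤lindisc
    ; candidate = ∈-filter⁺ inUnitCube? (∈-map⁺ (λ S → tail (vertexOf S)) S∈)
                    (λ j → subst (0ℚ ≤_) (y≗ (suc j)) (proj₁ (cube′ j)) , subst (_≤ 1ℚ) (y≗ (suc j)) (proj₂ (cube′ j))) }
    where
    open LiftedVertex (liftedVertex w cube 0<lindisc QP.≤-refl) renaming (cube to cube′)
    y≗ : ∀ j → y j ≡ vertexOf S j
    y≗ = vertexOf-unique S y S-size determines S-tight
    S∈ : S ∈ tuples (suc n) allConstraints
    S∈ = ∈-tuples (suc n) allConstraints S S-size S⊆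

  candidates-cube : All InUnitCube candidates
  candidates-cube = All.tabulate (λ u∈ → proj₂ (∈-filter⁻ inUnitCube? {xs = vertexPoints} u∈))

  opaque
    deepHole : Vector n
    deepHole = argmax (lindiscAt A) origin candidates

    deepHole-cube : InUnitCube deepHole
    deepHole-cube = argmax-all (lindiscAt A) (λ j → QP.≤-refl , QP.<⇒≤ 0<1) candidates-cube

    ≤-lindisc-deepHole : ∀ {u} → u ∈ candidates → lindiscAt A u ≤ lindiscAt A deepHole
    ≤-lindisc-deepHole = All.lookup (f[xs]≤f[argmax] origin candidates)

    deepHole-origin⊎candidate : deepHole ≡ origin ⊎ deepHole ∈ candidates
    deepHole-origin⊎candidate = argmax-sel (lindiscAt A) origin candidates

  deepHole-deep : ∀ w → InUnitCube w → lindiscAt A w ≤ lindiscAt A deepHole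
  deepHole-deep w cube with 0ℚ QP.<? lindiscAt A w
  ... | no  lindisc≯0 = QP.≤-trans (QP.≮⇒≥ lindisc≯0) (lindiscAt-nonNeg A deepHole)
  ... | yes 0<lindisc = QP.≤-trans lindisc≤ (QP.≤-trans ≤lindisc (≤-lindisc-deepHole candidate))
    where open Dominating (dominating w cube 0<lindisc)

  VertexCoordinate : ℚ → Set
  VertexCoordinate q = q ≡ 0ℚ ⊎ Σ (List Constraint) λ S → S ∈ tuples (suc n) allConstraints × Σ (Fin (suc n)) λ j → q ≡ vertexOf S j

  candidate-coordinates : ∀ {u} → u ∈ candidates → ∀ j → VertexCoordinate (u j)
  candidate-coordinates u∈ j with ∈-map⁻ (λ S → tail (vertexOf S)) (proj₁ (∈-filter⁻ inUnitCube? {xs = vertexPoints} u∈))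
  ... | S , S∈ , refl = inj₂ (S , S∈ , suc j , refl)

  deepHole-coordinates : ∀ j → VertexCoordinate (deepHole j)
  deepHole-coordinates j with deepHole-origin⊎candidate
  ... | inj₁ deepHole≡origin = inj₁ (cong (λ u → u j) deepHole≡origin)
  ... | inj₂ deepHole∈       = candidate-coordinates deepHole∈ j

  -- At a deep hole with positive discrepancy, the dominating vertex is squeezed between
  -- lindiscAt A deepHole and itself.
  lindisc-deepHole-coordinate : VertexCoordinate (lindiscAt A deepHole)
  lindisc-deepHole-coordinate with 0ℚ QP.<? lindiscAt A deepHole
  ... | no  lindisc≯0 = inj₁ (QP.≤-antisym (QP.≮⇒≥ lindisc≯0) (lindiscAt-nonNeg A deepHole))
  ... | yes 0<lindisc = inj₂ (S , S∈ , zero ,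
          QP.≤-antisym lindisc≤ (QP.≤-trans ≤lindisc (≤-lindisc-deepHole candidate)))
    where open Dominating (dominating deepHole deepHole-cube 0<lindisc)

module CandidateBits {m n : ℕ} (A : Matrix m n) where

  open import Data.Nat as ℕ using (zero; suc; _^_; _!; s≤s)
  open import Data.Nat.Properties as NP using ()
  open import Data.Nat.Divisibility as Div using ()
  open import Data.Integer as ℤ using (+_)
  open import Data.Rational as ℚ using (ℚ; 0ℚ; 1ℚ; _*_)
  open import Data.Rational.Properties as QP using ()
  open import Data.Rational.Solver using (module +-*-Solver)
  open import Data.Fin using (Fin; zero; suc)
  open import Data.Bool using (true; false)
  open import Data.List using (List; []; _∷_; map; length)
  open import Data.List.Properties using (length-map)
  open import Data.List.Relation.Unary.All using (All; []; _∷_)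
  open import Data.Product using (_,_; proj₁; proj₂)
  open import Data.Sum using (inj₁; inj₂)
  open import Relation.Binary.PropositionalEquality
  open import Relation.Nullary using (Dec; yes; no)
  open import Defs
  open RationalFacts
  open FinSums
  open Determinant
  open CramersRule using (setAt)
  open BoundedIntegers
  open BitLength
  open PolynomialBound
  open LindiscFacts using (polarity)
  open ListFacts using (length-∈-tuples)
  open LiftedSystem A
  open Candidates A
  open +-*-Solver

  N : ℕ
  N = n ℕ.+ bitsMat A ℕ.+ 1

  private
    B H : ℕ
    B = bitsMat A
    H = entryBound n B

    ∣numerator∣≤2^B : ∀ i j → ℤ.∣ ℚ.numerator (A i j) ∣ ℕ.≤ 2 ^ B
    ∣numerator∣≤2^B i j = NP.≤-trans (∣numerator∣≤2^bitsℚ (A i j)) (NP.^-monoʳ-≤ 2 (bitsℚ-entry≤bitsMat A i j))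

    denominators≤2^B : denominators ℕ.≤ 2 ^ B
    denominators≤2^B = prodFinℕ≤2^sumFinℕ _ (λ i → sumFinℕ (λ j → bitsℚ (A i j)))
      (λ i → prodFinℕ≤2^sumFinℕ _ (λ j → bitsℚ (A i j)) (λ j → denominator≤2^bitsℚ (A i j)))

    2^B≤2^B*2^B : 2 ^ B ℕ.≤ 2 ^ B ℕ.* 2 ^ B
    2^B≤2^B*2^B = NP.m≤m*n (2 ^ B) (2 ^ B) {{ℕ.>-nonZero (1≤2^ B)}}

    2^B*2^B≤H : 2 ^ B ℕ.* 2 ^ B ℕ.≤ H
    2^B*2^B≤H = NP.m≤m+n (2 ^ B ℕ.* 2 ^ B) _

    1≤H : 1 ℕ.≤ H
    1≤H = NP.≤-trans (1≤2^ B) (NP.≤-trans 2^B≤2^B*2^B 2^B*2^B≤H)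

    scale*entry : ∀ i k → BoundedInt (2 ^ B ℕ.* 2 ^ B) (scale * A i k)
    scale*entry i k = BoundedInt-mono (NP.*-mono-≤ (∣numerator∣≤2^B i k) denominators≤2^B)
      (denominator∣⇒BoundedInt (A i k) denominators
        (Div.∣-trans (∣prodFinℕ (λ j → ℚ.denominatorℕ (A i j)) k) (∣prodFinℕ (λ i → prodFinℕ (λ j → ℚ.denominatorℕ (A i j))) i)))

    BoundedInt-polarity : ∀ s → BoundedInt 1 (polarity s)
    BoundedInt-polarity true  = BoundedInt-1
    BoundedInt-polarity false = BoundedInt-neg BoundedInt-1

    polarity-swap : ∀ s L a → polarity s * (L * a) ≡ L * (polarity s * a)
    polarity-swap s = solve 3 (λ g L a → g :* (L :* a) := L :* (g :* a)) refl (polarity s)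

  coefficients-bounded : ∀ c → BoundedRow H (coefficients c)
  coefficients-bounded (lower j)   zero    = BoundedInt-0
  coefficients-bounded (lower j)   (suc k) = BoundedInt-mono 1≤H (BoundedInt-δ k j)
  coefficients-bounded (upper j)   zero    = BoundedInt-0
  coefficients-bounded (upper j)   (suc k) = BoundedInt-mono 1≤H (BoundedInt-neg (BoundedInt-δ k j))
  coefficients-bounded (row i s x) zero    =
    BoundedInt-mono (NP.≤-trans denominators≤2^B (NP.≤-trans 2^B≤2^B*2^B 2^B*2^B≤H)) (BoundedInt-neg (+ denominators , refl , NP.≤-refl))
  coefficients-bounded (row i s x) (suc k) =
    BoundedInt-mono (NP.≤-trans (NP.≤-reflexive (NP.+-identityʳ _)) 2^B*2^B≤H)
      (subst (BoundedInt _) (polarity-swap s scale (A i k)) (BoundedInt-* (BoundedInt-polarity s) (scale*entry i k)))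

  bound-bounded : ∀ c → BoundedInt H (bound c)
  bound-bounded (lower j)   = BoundedInt-0
  bound-bounded (upper j)   = BoundedInt-mono 1≤H (BoundedInt-neg BoundedInt-1)
  bound-bounded (row i s x) =
    BoundedInt-mono (NP.≤-trans (NP.≤-reflexive (NP.+-identityʳ _)) (NP.m≤n+m _ (2 ^ B ℕ.* 2 ^ B)))
      (subst (BoundedInt _) rearrange
        (BoundedInt-* (BoundedInt-polarity s)
          (BoundedInt-sumFin (λ j → (scale * A i j) * bit (x j)) (2 ^ B ℕ.* 2 ^ B)
            (λ j → BoundedInt-mono (NP.≤-reflexive (NP.*-identityʳ _)) (BoundedInt-* (scale*entry i j) (BoundedInt-bit (x j)))))))
    where
    rearrange : polarity s * sumFin (λ j → (scale * A i j) * bit (x j)) ≡ scale * (polarity s * (A i ·ᵥ toVec x))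
    rearrange = trans (cong (polarity s *_) (trans (sumFin-cong (λ j → QP.*-assoc scale (A i j) (bit (x j))))
                                                    (sym (*-distribˡ-sumFin scale (λ j → A i j * bit (x j))))))
                      (polarity-swap s scale (A i ·ᵥ toVec x))

  private
    setAt-bounded : ∀ {d} (j : Fin d) b (r : Vector d) → BoundedRow H r → BoundedInt H b → BoundedRow H (setAt j b r)
    setAt-bounded zero    b r hr hb zero    = hb
    setAt-bounded zero    b r hr hb (suc k) = hr (suc k)
    setAt-bounded (suc j) b r hr hb zero    = hr zero
    setAt-bounded (suc j) b r hr hb (suc k) = setAt-bounded j b (λ k → r (suc k)) (λ k → hr (suc k)) hb k

    rows-bounded : ∀ S → All (BoundedRow H) (map coefficients S)
    rows-bounded []      = []
    rows-bounded (c ∷ S) = coefficients-bounded c ∷ rows-bounded S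

    numerator-rows-bounded : ∀ j S → All (BoundedRow H) (map (λ c → setAt j (bound c) (coefficients c)) S)
    numerator-rows-bounded j []      = []
    numerator-rows-bounded j (c ∷ S) = setAt-bounded j (bound c) (coefficients c) (coefficients-bounded c) (bound-bounded c)
                                       ∷ numerator-rows-bounded j S

  vertexOf-singular : ∀ S j → det (map coefficients S) ≡ 0ℚ → vertexOf S j ≡ 0ℚ
  vertexOf-singular S j det≡0 = trans (cong (λ D → numerator S j * inv D) det≡0) (QP.*-zeroʳ (numerator S j))

  bitsℚ-vertexOf-regular : ∀ S j → length S ≡ suc n → det (map coefficients S) ≢ 0ℚ →
                           bitsℚ (vertexOf S j) ℕ.≤ coordinateBits n B
  bitsℚ-vertexOf-regular S j len det≢0 = NP.≤-trans (bitsℚ-fraction (vertexOf S j) P Q Q≢0 vertexOf*Q≡P)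
                                                    (s≤s (NP.+-mono-≤ (bitsℕ-mono ∣P∣≤) (bitsℕ-mono ∣Q∣≤)))
    where
    D = det (map coefficients S)
    detQ : BoundedInt (suc n ! ℕ.* H ^ suc n) D
    detQ = det-BoundedInt H (map coefficients S) (trans (length-map coefficients S) len) (rows-bounded S)
    detP : BoundedInt (suc n ! ℕ.* H ^ suc n) (numerator S j)
    detP = det-BoundedInt H (map (λ c → setAt j (bound c) (coefficients c)) S) (trans (length-map _ S) len)
                          (numerator-rows-bounded j S)
    Q = proj₁ detQ
    P = proj₁ detP
    ∣Q∣≤ = proj₂ (proj₂ detQ)
    ∣P∣≤ = proj₂ (proj₂ detP)
    Q≢0 : Q ≢ + 0
    Q≢0 Q≡0 = det≢0 (trans (proj₁ (proj₂ detQ)) (cong fromℤ Q≡0))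
    vertexOf*Q≡P : vertexOf S j * fromℤ Q ≡ fromℤ P
    vertexOf*Q≡P = begin
        (numerator S j * inv D) * fromℤ Q   ≡⟨ cong ((numerator S j * inv D) *_) (sym (proj₁ (proj₂ detQ))) ⟩
        (numerator S j * inv D) * D         ≡⟨ QP.*-assoc (numerator S j) (inv D) D ⟩
        numerator S j * (inv D * D)         ≡⟨ cong (numerator S j *_) (inv-inverseˡ D det≢0) ⟩
        numerator S j * 1ℚ                  ≡⟨ QP.*-identityʳ (numerator S j) ⟩
        numerator S j                       ≡⟨ proj₁ (proj₂ detP) ⟩
        fromℤ P                             ∎
      where open ≡-Reasoning

  bitsℚ-vertexOf : ∀ S j → length S ≡ suc n → bitsℚ (vertexOf S j) ℕ.≤ 9 ℕ.* (N ℕ.* N)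
  bitsℚ-vertexOf S j len = by-cases (det (map coefficients S) QP.≟ 0ℚ)
    where
    by-cases : Dec (det (map coefficients S) ≡ 0ℚ) → bitsℚ (vertexOf S j) ℕ.≤ 9 ℕ.* (N ℕ.* N)
    by-cases (yes det≡0) = subst (λ q → bitsℚ q ℕ.≤ 9 ℕ.* (N ℕ.* N)) (sym (vertexOf-singular S j det≡0)) (4≤9N² n B)
    by-cases (no det≢0)  = NP.≤-trans (bitsℚ-vertexOf-regular S j len det≢0) (coordinateBits≤ n B)

  bitsℚ-VertexCoordinate : ∀ {q} → VertexCoordinate q → bitsℚ q ℕ.≤ 9 ℕ.* (N ℕ.* N)
  bitsℚ-VertexCoordinate (inj₁ refl) = 4≤9N² n B
  bitsℚ-VertexCoordinate (inj₂ (S , S∈ , j , refl)) = bitsℚ-vertexOf S j (length-∈-tuples (suc n) allConstraints S∈)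

open import Defs
open import Data.Nat using (ℕ; _+_; _*_; _^_; _≤_)
open import Data.Nat.Properties using (≤-trans)
open import Data.Product using (Σ; _×_; _,_)
open BitLength using (sumFinℕ-≤)
open PolynomialBound using (n*9N²≤9N³; 9N²≤9N³)

lemma2p1 : Σ ℕ λ c → Σ ℕ λ k →
    ∀ m n (A : Matrix m n) → Σ (Vector n) λ w* →
      IsDeepHole A w*
      × bitsVec w* ≤ c * (n + bitsMat A + 1) ^ k
      × bitsℚ (lindiscAt A w*) ≤ c * (n + bitsMat A + 1) ^ k
lemma2p1 = 9 , 3 , λ m n A →
  let open Candidates A
      open CandidateBits A
  in deepHole
   , (deepHole-cube , deepHole-deep)
   , ≤-trans (sumFinℕ-≤ (λ j → bitsℚ (deepHole j)) _ (λ j → bitsℚ-VertexCoordinate (deepHole-coordinates j)))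
             (n*9N²≤9N³ n (bitsMat A))
   , ≤-trans (bitsℚ-VertexCoordinate lindisc-deepHole-coordinate) (9N²≤9N³ n (bitsMat A))
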